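{- The categories $\mathsf{uS\ell g}$ and $\mathsf{SMV}$ lack some pullbacks, as well as some equalizers.
   Context: An $\ell$-group is a lattice-ordered abelian group. A unit of $G$ is $u\ge0$ such that each $g\in G$ satisfies $|g|\le nu$ for some $n\in\mathbb Z_{>0}$. A singular element is $s\ge0$ with $a\wedge(s-a)=0$ for all $0\le a\le s$. A Specker $\ell$-group is an $\ell$-group generated as a group by its singular elements. $\mathsf{uS\ell g}$ has objects the pairs $(S,u)$ with $S$ Specker and $u$ a unit, and morphisms the $\ell$-homomorphisms preserving the unit. For a unital $\ell$-group $(G,u)$, $\Gamma(G,u)$ is the MV-algebra on $[0,u]$ with $\neg x=u-x$, $x\oplus y=(x+y)\wedge u$. A Specker MV-algebra is an MV-algebra isomorphic to some $\Gamma(S,u)$ with $(S,u)$ a unital Specker $\ell$-group; $\mathsf{SMV}$ is the category of Specker MV-algebras and MV-homomorphisms. -}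

module Defs where

open import Level using () renaming (zero to 0ℓ)
open import Data.Nat using (ℕ; zero; suc; _<_)
open import Data.Product using (Σ; _×_; _,_)
open import Data.Empty using (⊥)
open import Relation.Nullary using (¬_)
open import Relation.Binary.PropositionalEquality using (_≡_)
open import Algebra.Core using (Op₁; Op₂)
open import Algebra.Structures using (IsAbelianGroup)
open import Algebra.Lattice.Structures using (IsLattice)

-- Abelian ℓ-groups (lattice-ordered abelian groups), equational presentation:
-- an abelian group and a lattice on the same carrier such that addition
-- distributes over join (translation invariance).

record LGroup : Set₁ where
  infixl 6 _+_ _-_
  infix 4 _≤_
  field
    Carrier : Set
    _+_ : Op₂ Carrier
    0#  : Carrier
    -_  : Op₁ Carrier
    _∨_ : Op₂ Carrier
    _∧_ : Op₂ Carrier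
    isAbelianGroup : IsAbelianGroup _≡_ _+_ 0# -_
    isLattice      : IsLattice _≡_ _∨_ _∧_
    +-distribˡ-∨   : ∀ a b c → a + (b ∨ c) ≡ (a + b) ∨ (a + c)

  _≤_ : Carrier → Carrier → Set
  a ≤ b = a ∧ b ≡ a

  _-_ : Op₂ Carrier
  a - b = a + (- b)

  ∣_∣ : Op₁ Carrier
  ∣ g ∣ = g ∨ (- g)

  _·_ : ℕ → Carrier → Carrier
  zero  · g = 0#
  suc n · g = g + (n · g)

  IsUnit : Carrier → Set
  IsUnit u = (0# ≤ u) × (∀ g → Σ ℕ λ n → (0 < n) × (∣ g ∣ ≤ n · u))

  IsSingular : Carrier → Set
  IsSingular s = (0# ≤ s) × (∀ a → 0# ≤ a → a ≤ s → a ∧ (s - a) ≡ 0#)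

  data Gen (P : Carrier → Set) : Carrier → Set where
    gen-base : ∀ {g} → P g → Gen P g
    gen-zero : Gen P 0#
    gen-neg  : ∀ {g} → Gen P g → Gen P (- g)
    gen-add  : ∀ {g h} → Gen P g → Gen P h → Gen P (g + h)

  IsSpecker : Set
  IsSpecker = ∀ g → Gen IsSingular g

open LGroup

record LHom (G H : LGroup) : Set where
  field
    fun   : Carrier G → Carrier H
    +-hom : ∀ a b → fun (_+_ G a b) ≡ _+_ H (fun a) (fun b)
    ∧-hom : ∀ a b → fun (_∧_ G a b) ≡ _∧_ H (fun a) (fun b)
    ∨-hom : ∀ a b → fun (_∨_ G a b) ≡ _∨_ H (fun a) (fun b)

record USℓg : Set₁ where
  field
    group   : LGroup
    unit    : Carrier group
    isUnit  : IsUnit group unit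
    specker : IsSpecker group

open USℓg

record USℓgHom (A B : USℓg) : Set where
  field
    hom      : LHom (group A) (group B)
    unit-hom : LHom.fun hom (unit A) ≡ unit B

record MVAlgebra : Set₁ where
  infixl 6 _⊕_
  field
    Carrier : Set
    _⊕_ : Op₂ Carrier
    ∼_  : Op₁ Carrier
    0#  : Carrier
    ⊕-assoc     : ∀ x y z → (x ⊕ y) ⊕ z ≡ x ⊕ (y ⊕ z)
    ⊕-comm      : ∀ x y → x ⊕ y ≡ y ⊕ x
    ⊕-identityʳ : ∀ x → x ⊕ 0# ≡ x
    ¬-involutive : ∀ x → ∼ (∼ x) ≡ x
    ⊕-zeroʳ     : ∀ x → x ⊕ (∼ 0#) ≡ ∼ 0#
    łukasiewicz : ∀ x y → (∼ (∼ x ⊕ y)) ⊕ y ≡ (∼ (∼ y ⊕ x)) ⊕ x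

record MVHom (A B : MVAlgebra) : Set where
  field
    fun   : MVAlgebra.Carrier A → MVAlgebra.Carrier B
    ⊕-hom : ∀ x y → fun (MVAlgebra._⊕_ A x y) ≡ MVAlgebra._⊕_ B (fun x) (fun y)
    ¬-hom : ∀ x → fun (MVAlgebra.∼_ A x) ≡ MVAlgebra.∼_ B (fun x)
    0-hom : fun (MVAlgebra.0# A) ≡ MVAlgebra.0# B

-- An MV-isomorphism φ : A ≅ Γ(S,u), written out: φ is an injective map
-- of A onto the interval [0,u] of S sending 0 to 0, x ⊕ y to
-- (φx + φy) ∧ u and ∼x to u - φx.
IsoToΓ : (A : MVAlgebra) (S : USℓg) → Set
IsoToΓ A S =
  Σ (MVAlgebra.Carrier A → Carrier G) λ φ →
    (∀ x y → φ x ≡ φ y → x ≡ y)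
  × (∀ x → (_≤_ G (0# G) (φ x)) × (_≤_ G (φ x) u))
  × (∀ y → _≤_ G (0# G) y → _≤_ G y u → Σ (MVAlgebra.Carrier A) λ x → φ x ≡ y)
  × (φ (MVAlgebra.0# A) ≡ 0# G)
  × (∀ x y → φ (MVAlgebra._⊕_ A x y) ≡ _∧_ G (_+_ G (φ x) (φ y)) u)
  × (∀ x → φ (MVAlgebra.∼_ A x) ≡ _-_ G u (φ x))
  where
    G = group S
    u = unit S

record SMVObj : Set₁ where
  field
    alg     : MVAlgebra
    speckerGroup : USℓg
    iso     : IsoToΓ alg speckerGroup

SMVHom : SMVObj → SMVObj → Set
SMVHom A B = MVHom (SMVObj.alg A) (SMVObj.alg B)

-- Concrete categories (morphisms are structure-preserving maps,
-- composition is composition of maps, equality of morphisms is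
-- (pointwise) equality of the underlying maps), and (non-)existence
-- of equalizers and pullbacks in them.

record ConcreteCat : Set₂ where
  field
    Obj : Set₁
    El  : Obj → Set
    Hom : Obj → Obj → Set
    ap  : ∀ {A B} → Hom A B → El A → El B

module _ (C : ConcreteCat) where
  open ConcreteCat C

  _≈_ : ∀ {A B} → Hom A B → Hom A B → Set
  f ≈ g = ∀ x → ap f x ≡ ap g x

  IsEqualizer : ∀ {A B E} (f g : Hom A B) (e : Hom E A) → Set₁
  IsEqualizer {A} {B} {E} f g e =
      (∀ x → ap f (ap e x) ≡ ap g (ap e x))
    × (∀ Z (z : Hom Z A) → (∀ x → ap f (ap z x) ≡ ap g (ap z x)) →
         Σ (Hom Z E) λ h → (∀ x → ap e (ap h x) ≡ ap z x)
                         × (∀ (h' : Hom Z E) → (∀ x → ap e (ap h' x) ≡ ap z x) → h' ≈ h))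

  HasEqualizer : ∀ {A B} (f g : Hom A B) → Set₁
  HasEqualizer {A} f g = Σ Obj λ E → Σ (Hom E A) λ e → IsEqualizer f g e

  IsPullback : ∀ {A B D P} (f : Hom A D) (g : Hom B D) (p₁ : Hom P A) (p₂ : Hom P B) → Set₁
  IsPullback {A} {B} {D} {P} f g p₁ p₂ =
      (∀ x → ap f (ap p₁ x) ≡ ap g (ap p₂ x))
    × (∀ Z (q₁ : Hom Z A) (q₂ : Hom Z B) → (∀ x → ap f (ap q₁ x) ≡ ap g (ap q₂ x)) →
         Σ (Hom Z P) λ h → ((∀ x → ap p₁ (ap h x) ≡ ap q₁ x) × (∀ x → ap p₂ (ap h x) ≡ ap q₂ x))
           × (∀ (h' : Hom Z P) → (∀ x → ap p₁ (ap h' x) ≡ ap q₁ x) →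
                 (∀ x → ap p₂ (ap h' x) ≡ ap q₂ x) → h' ≈ h))

  HasPullback : ∀ {A B D} (f : Hom A D) (g : Hom B D) → Set₁
  HasPullback {A} {B} f g = Σ Obj λ P → Σ (Hom P A) λ p₁ → Σ (Hom P B) λ p₂ → IsPullback f g p₁ p₂

  LacksSomePullback : Set₁
  LacksSomePullback = Σ Obj λ A → Σ Obj λ B → Σ Obj λ D →
    Σ (Hom A D) λ f → Σ (Hom B D) λ g → ¬ HasPullback f g

  LacksSomeEqualizer : Set₁
  LacksSomeEqualizer = Σ Obj λ A → Σ Obj λ B →
    Σ (Hom A B) λ f → Σ (Hom A B) λ g → ¬ HasEqualizer f g

uSℓg : ConcreteCat
uSℓg = record
  { Obj = USℓg
  ; El  = λ A → Carrier (group A)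
  ; Hom = USℓgHom
  ; ap  = λ f → LHom.fun (USℓgHom.hom f)
  }

SMV : ConcreteCat
SMV = record
  { Obj = SMVObj
  ; El  = λ A → MVAlgebra.Carrier (SMVObj.alg A)
  ; Hom = SMVHom
  ; ap  = MVHom.fun
  }

-- Let A be the group of eventually constant integer sequences times ℤ, with unit (2̄, 1),
-- and f, g : A → (ℤ, 2) the maps f(σ, k) = lim σ and g(σ, k) = 2k.  For each n the map
-- zₙ : (ℤ², (1, 2)) → A sending (c, d) to the sequence that is d at position n and 2c
-- elsewhere, paired with c, equalizes f and g.  Suppose e : E → A equalizes f and g and
-- every zₙ factors through e.  For a singular s of E, pick n beyond which e(s) is
-- constant and let y be the image of (0, 1) under the factorization of zₙ; then y ∧ s
-- lies below s, and evaluating its singularity condition at position n shows that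
-- lim e(s) is 0 or 1, hence 0 because it is even.  So lim ∘ e vanishes on the subgroup
-- generated by the singular elements, which is all of E when E is Specker; but it sends
-- the unit to 2.  The pullback of ⟨f, g⟩ : A → ℤ² along the diagonal is such an e.
-- Applying Γ gives the same counterexample for Specker MV-algebras; there the unit of E
-- must be reached from the singular elements by the truncated sums of Γ(E).

module Submission where

open import Defs
open import Algebra.Bundles using (AbelianGroup)
open import Algebra.Core using (Op₁; Op₂)
import Algebra.Definitions as Definitions
open import Algebra.Lattice.Bundles using (Lattice)
import Algebra.Lattice.Properties.Lattice as LatticeProperties
open import Algebra.Lattice.Structures using (IsLattice)
import Algebra.Properties.AbelianGroup as AbelianGroupProperties
import Algebra.Properties.CommutativeSemigroup as CommutativeSemigroupProperties
open import Axiom.UniquenessOfIdentityProofs using (module Decidable⇒UIP)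
open import Data.Empty using (⊥; ⊥-elim)
open import Data.Fin as Fin using (Fin; zero; suc; toℕ)
import Data.Fin.Properties as Fin
open import Data.Integer as ℤ using (ℤ; -[1+_])
import Data.Integer.Properties as ℤₚ
open import Data.List using (List; []; _∷_; length)
import Data.List as List
open import Data.List.Properties using (≡-dec)
open import Data.Nat as ℕ using (ℕ; zero; suc; s≤s)
import Data.Nat.Properties as ℕ
open import Data.Product using (Σ; _×_; _,_; proj₁; proj₂; zip; <_,_>)
open import Relation.Binary.Bundles using (Poset)
open import Relation.Binary.Definitions using (DecidableEquality)
open import Relation.Binary.Lattice using () renaming (IsLattice to IsOrderLattice)
open import Relation.Binary.PropositionalEquality
  using (_≡_; _≢_; refl; sym; trans; cong; cong₂; subst; subst₂; isEquivalence; module ≡-Reasoning)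
import Relation.Binary.Reasoning.PartialOrder as PosetReasoning
open import Relation.Nullary using (yes; no; ¬_; Dec)
open import Relation.Nullary.Decidable using (from-yes; _×-dec_)

-- Eventually constant sequences

module EventuallyConstant where

  open ≡-Reasoning

  -- A sequence is stored as a limit c and a prefix l, denoting l ++ c c c ….
  -- Trimming the trailing entries equal to c makes the representation unique.
  module _ {V : Set} (_≟_ : DecidableEquality V) where

    trim-∷ : V → V → List V → List V
    trim-∷ c x [] with x ≟ c
    ... | yes _ = []
    ... | no  _ = x ∷ []
    trim-∷ c x (y ∷ l) = x ∷ y ∷ l

    trim : V → List V → List V
    trim c []      = []
    trim c (x ∷ l) = trim-∷ c x (trim c l)

    valueAt : V → List V → ℕ → V
    valueAt c []      n       = c
    valueAt c (x ∷ l) zero    = x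
    valueAt c (x ∷ l) (suc n) = valueAt c l n

    valueAt-trim-∷ : ∀ c x l n → valueAt c (trim-∷ c x l) n ≡ valueAt c (x ∷ l) n
    valueAt-trim-∷ c x [] n with x ≟ c
    valueAt-trim-∷ c x [] zero    | yes x≡c = sym x≡c
    valueAt-trim-∷ c x [] (suc n) | yes _   = refl
    ... | no _ = refl
    valueAt-trim-∷ c x (y ∷ l) n = refl

    valueAt-trim : ∀ c l n → valueAt c (trim c l) n ≡ valueAt c l n
    valueAt-trim c []      n       = refl
    valueAt-trim c (x ∷ l) n = trans (valueAt-trim-∷ c x (trim c l) n) (tail n)
      where
      tail : ∀ n → valueAt c (x ∷ trim c l) n ≡ valueAt c (x ∷ l) n
      tail zero    = refl
      tail (suc n) = valueAt-trim c l n

    trim-trim-∷ : ∀ c x l → trim c l ≡ l → trim c (trim-∷ c x l) ≡ trim-∷ c x l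
    trim-trim-∷ c x [] _ with x ≟ c
    ... | yes _ = refl
    ... | no x≢c with x ≟ c
    ...   | yes x≡c = ⊥-elim (x≢c x≡c)
    ...   | no  _   = refl
    trim-trim-∷ c x (y ∷ l) l-trimmed = cong (trim-∷ c x) l-trimmed

    trim-idem : ∀ c l → trim c (trim c l) ≡ trim c l
    trim-idem c []      = refl
    trim-idem c (x ∷ l) = trim-trim-∷ c x (trim c l) (trim-idem c l)

    trim-∷-tail : ∀ c x m l → trim-∷ c x m ≡ x ∷ l → m ≡ l
    trim-∷-tail c x [] l eq with x ≟ c
    trim-∷-tail c x [] l       () | yes _
    trim-∷-tail c x [] []      eq | no _ = refl
    trim-∷-tail c x [] (_ ∷ _) () | no _
    trim-∷-tail c x (y ∷ m) l refl = refl

    trimmed-tail : ∀ c x l → trim c (x ∷ l) ≡ x ∷ l → trim c l ≡ l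
    trimmed-tail c x l = trim-∷-tail c x (trim c l) l

    trimmed-constant : ∀ c l → trim c l ≡ l → (∀ n → valueAt c l n ≡ c) → l ≡ []
    trimmed-constant c []      _         _     = refl
    trimmed-constant c (x ∷ l) x∷l-trimmed all-c
      with trimmed-constant c l (trimmed-tail c x l x∷l-trimmed) (λ n → all-c (suc n))
    ... | refl with x ≟ c | x∷l-trimmed
    ...   | yes _   | ()
    ...   | no  x≢c | _ = ⊥-elim (x≢c (all-c zero))

    trimmed-unique : ∀ c l l' → trim c l ≡ l → trim c l' ≡ l' →
                     (∀ n → valueAt c l n ≡ valueAt c l' n) → l ≡ l'
    trimmed-unique c [] [] _ _ _ = refl
    trimmed-unique c [] l'@(_ ∷ _) _ t' eq = sym (trimmed-constant c l' t' (λ n → sym (eq n)))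
    trimmed-unique c l@(_ ∷ _) [] t _ eq = trimmed-constant c l t eq
    trimmed-unique c (x ∷ l) (y ∷ l') t t' eq =
      cong₂ _∷_ (eq zero)
        (trimmed-unique c l l' (trimmed-tail c x l t) (trimmed-tail c y l' t') (λ n → eq (suc n)))

    valueAt-beyond : ∀ c l n → length l ℕ.≤ n → valueAt c l n ≡ c
    valueAt-beyond c []      n       _         = refl
    valueAt-beyond c (x ∷ l) (suc n) (s≤s l≤n) = valueAt-beyond c l n l≤n

    record Seq : Set where
      constructor seq
      field
        limit   : V
        prefix  : List V
        trimmed : trim limit prefix ≡ prefix

    open Seq public

    at : Seq → ℕ → V
    at a = valueAt (limit a) (prefix a)

    fromList : V → List V → Seq
    fromList c l = seq c (trim c l) (trim-idem c l)

    at-fromList : ∀ c l n → at (fromList c l) n ≡ valueAt c l n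
    at-fromList = valueAt-trim

    const : V → Seq
    const c = seq c [] refl

    at-limit : ∀ a → at a (length (prefix a)) ≡ limit a
    at-limit a = valueAt-beyond (limit a) (prefix a) _ ℕ.≤-refl

    ext : ∀ {a b} → (∀ n → at a n ≡ at b n) → a ≡ b
    ext {seq c l t} {seq c' l' t'} eq
      with trans (sym (valueAt-beyond c l N (ℕ.m≤m+n _ _)))
                 (trans (eq N) (valueAt-beyond c' l' N (ℕ.m≤n+m _ _)))
      where N = length l ℕ.+ length l'
    ... | refl with trimmed-unique c l l' t t' eq
    ...   | refl with Decidable⇒UIP.≡-irrelevant (≡-dec _≟_) t t'
    ...     | refl = refl

  open Seq public

  module _ {V W : Set} {_≟V_ : DecidableEquality V} {_≟W_ : DecidableEquality W} where

    map : (V → W) → Seq _≟V_ → Seq _≟W_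
    map f a = fromList _≟W_ (f (limit a)) (List.map f (prefix a))

    at-map : ∀ f a n → at _≟W_ (map f a) n ≡ f (at _≟V_ a n)
    at-map f a n = trans (at-fromList _≟W_ (f (limit a)) (List.map f (prefix a)) n) (valueAt-map (limit a) (prefix a) n)
      where
      valueAt-map : ∀ c l n → valueAt _≟W_ (f c) (List.map f l) n ≡ f (valueAt _≟V_ c l n)
      valueAt-map c []      n       = refl
      valueAt-map c (x ∷ l) zero    = refl
      valueAt-map c (x ∷ l) (suc n) = valueAt-map c l n

  module _ {V : Set} {_≟_ : DecidableEquality V} where

    private
      S = Seq _≟_
      at′ = at _≟_
      module ≈V = Definitions {A = V} _≡_
      module ≈S = Definitions {A = S} _≡_

    lift₁ : Op₁ V → Op₁ S
    lift₁ = map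

    at-lift₁ : ∀ i a n → at′ (lift₁ i a) n ≡ i (at′ a n)
    at-lift₁ = at-map

    zipPadded : Op₂ V → V → V → List V → List V → List V
    zipPadded f c d []      []      = []
    zipPadded f c d []      (y ∷ l) = f c y ∷ zipPadded f c d [] l
    zipPadded f c d (x ∷ k) []      = f x d ∷ zipPadded f c d k []
    zipPadded f c d (x ∷ k) (y ∷ l) = f x y ∷ zipPadded f c d k l

    lift₂ : Op₂ V → Op₂ S
    lift₂ f a b = fromList _≟_ (f (limit a) (limit b)) (zipPadded f (limit a) (limit b) (prefix a) (prefix b))

    at-lift₂ : ∀ f a b n → at′ (lift₂ f a b) n ≡ f (at′ a n) (at′ b n)
    at-lift₂ f a b n = trans (at-fromList _≟_ _ (zipPadded f c d (prefix a) (prefix b)) n) (valueAt-zip (prefix a) (prefix b) n)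
      where
      c = limit a
      d = limit b
      valueAt-zip : ∀ k l n → valueAt _≟_ (f c d) (zipPadded f c d k l) n ≡ f (valueAt _≟_ c k n) (valueAt _≟_ d l n)
      valueAt-zip []      []      n       = refl
      valueAt-zip []      (y ∷ l) zero    = refl
      valueAt-zip []      (y ∷ l) (suc n) = valueAt-zip [] l n
      valueAt-zip (x ∷ k) []      zero    = refl
      valueAt-zip (x ∷ k) []      (suc n) = valueAt-zip k [] n
      valueAt-zip (x ∷ k) (y ∷ l) zero    = refl
      valueAt-zip (x ∷ k) (y ∷ l) (suc n) = valueAt-zip k l n

    module _ {f : Op₂ V} where

      lift₂-assoc : ≈V.Associative f → ≈S.Associative (lift₂ f)
      lift₂-assoc assoc a b c = ext _≟_ λ n → begin
        at′ (lift₂ f (lift₂ f a b) c) n             ≡⟨ at-lift₂ f (lift₂ f a b) c n ⟩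
        f (at′ (lift₂ f a b) n) (at′ c n)           ≡⟨ cong (λ v → f v _) (at-lift₂ f a b n) ⟩
        f (f (at′ a n) (at′ b n)) (at′ c n)         ≡⟨ assoc _ _ _ ⟩
        f (at′ a n) (f (at′ b n) (at′ c n))         ≡⟨ cong (f _) (at-lift₂ f b c n) ⟨
        f (at′ a n) (at′ (lift₂ f b c) n)           ≡⟨ at-lift₂ f a (lift₂ f b c) n ⟨
        at′ (lift₂ f a (lift₂ f b c)) n             ∎

      lift₂-comm : ≈V.Commutative f → ≈S.Commutative (lift₂ f)
      lift₂-comm comm a b = ext _≟_ λ n →
        trans (at-lift₂ f a b n) (trans (comm _ _) (sym (at-lift₂ f b a n)))

      lift₂-identityˡ : ∀ {e} → ≈V.LeftIdentity e f → ≈S.LeftIdentity (const _≟_ e) (lift₂ f)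
      lift₂-identityˡ id a = ext _≟_ λ n → trans (at-lift₂ f (const _≟_ _) a n) (id _)

      lift₂-identityʳ : ∀ {e} → ≈V.RightIdentity e f → ≈S.RightIdentity (const _≟_ e) (lift₂ f)
      lift₂-identityʳ id a = ext _≟_ λ n → trans (at-lift₂ f a (const _≟_ _) n) (id _)

      lift₂-inverseˡ : ∀ {e i} → ≈V.LeftInverse e i f → ≈S.LeftInverse (const _≟_ e) (lift₁ i) (lift₂ f)
      lift₂-inverseˡ {i = i} inv a = ext _≟_ λ n →
        trans (at-lift₂ f (lift₁ i a) a n) (trans (cong (λ v → f v _) (at-lift₁ i a n)) (inv _))

      lift₂-inverseʳ : ∀ {e i} → ≈V.RightInverse e i f → ≈S.RightInverse (const _≟_ e) (lift₁ i) (lift₂ f)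
      lift₂-inverseʳ {i = i} inv a = ext _≟_ λ n →
        trans (at-lift₂ f a (lift₁ i a) n) (trans (cong (f _) (at-lift₁ i a n)) (inv _))

      lift₂-absorbs : ∀ {g} → f ≈V.Absorbs g → lift₂ f ≈S.Absorbs lift₂ g
      lift₂-absorbs {g} absorbs a b = ext _≟_ λ n →
        trans (at-lift₂ f a (lift₂ g a b) n) (trans (cong (f _) (at-lift₂ g a b n)) (absorbs _ _))

      lift₂-distribˡ : ∀ {g} → f ≈V.DistributesOverˡ g → lift₂ f ≈S.DistributesOverˡ lift₂ g
      lift₂-distribˡ {g} distrib a b c = ext _≟_ λ n → begin
        at′ (lift₂ f a (lift₂ g b c)) n                        ≡⟨ at-lift₂ f a (lift₂ g b c) n ⟩
        f (at′ a n) (at′ (lift₂ g b c) n)                      ≡⟨ cong (f _) (at-lift₂ g b c n) ⟩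
        f (at′ a n) (g (at′ b n) (at′ c n))                    ≡⟨ distrib _ _ _ ⟩
        g (f (at′ a n) (at′ b n)) (f (at′ a n) (at′ c n))      ≡⟨ cong₂ g (at-lift₂ f a b n) (at-lift₂ f a c n) ⟨
        g (at′ (lift₂ f a b) n) (at′ (lift₂ f a c) n)          ≡⟨ at-lift₂ g (lift₂ f a b) (lift₂ f a c) n ⟨
        at′ (lift₂ g (lift₂ f a b) (lift₂ f a c)) n            ∎

    lift₁-involutive : ∀ {i} → ≈V.Involutive i → ≈S.Involutive (lift₁ i)
    lift₁-involutive {i} invol a = ext _≟_ λ n →
      trans (at-lift₁ i (lift₁ i a) n) (trans (cong i (at-lift₁ i a n)) (invol _))

    _◂_ : V → S → S
    x ◂ a = fromList _≟_ (limit a) (x ∷ prefix a)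

    at-◂-zero : ∀ x a → at′ (x ◂ a) zero ≡ x
    at-◂-zero x a = at-fromList _≟_ (limit a) (x ∷ prefix a) zero

    at-◂-suc : ∀ x a n → at′ (x ◂ a) (suc n) ≡ at′ a n
    at-◂-suc x a n = at-fromList _≟_ (limit a) (x ∷ prefix a) (suc n)

    ◂-ext : ∀ {x a b} → (at′ b zero ≡ x) → (∀ n → at′ b (suc n) ≡ at′ a n) → x ◂ a ≡ b
    ◂-ext {x} {a} {b} eq₀ eqₛ = ext _≟_ λ where
      zero    → trans (at-◂-zero x a) (sym eq₀)
      (suc n) → trans (at-◂-suc x a n) (sym (eqₛ n))

    ◂-seq : ∀ c x l t → x ◂ seq c l (trimmed-tail _≟_ c x l t) ≡ seq c (x ∷ l) t
    ◂-seq c x l t = ◂-ext {a = seq c l (trimmed-tail _≟_ c x l t)} refl (λ _ → refl)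

    ◂-const : ∀ d → d ◂ const _≟_ d ≡ const _≟_ d
    ◂-const d = ◂-ext {a = const _≟_ d} refl (λ _ → refl)

    ◂-lift₁ : ∀ (i : Op₁ V) x a → i x ◂ lift₁ i a ≡ lift₁ i (x ◂ a)
    ◂-lift₁ i x a = ◂-ext {a = lift₁ i a}
      (trans (at-lift₁ i (x ◂ a) zero) (cong i (at-◂-zero x a)))
      (λ n → trans (at-lift₁ i (x ◂ a) (suc n))
               (trans (cong i (at-◂-suc x a n)) (sym (at-lift₁ i a n))))

    ◂-lift₂ : ∀ (f : Op₂ V) x y a b → f x y ◂ lift₂ f a b ≡ lift₂ f (x ◂ a) (y ◂ b)
    ◂-lift₂ f x y a b = ◂-ext {a = lift₂ f a b}
      (trans (at-lift₂ f (x ◂ a) (y ◂ b) zero) (cong₂ f (at-◂-zero x a) (at-◂-zero y b)))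
      (λ n → trans (at-lift₂ f (x ◂ a) (y ◂ b) (suc n))
               (trans (cong₂ f (at-◂-suc x a n) (at-◂-suc y b n)) (sym (at-lift₂ f a b n))))

    ◂-pointwise : ∀ (P : V → Set) x a → P x → (∀ n → P (at′ a n)) → ∀ n → P (at′ (x ◂ a) n)
    ◂-pointwise P x a px pa zero    = subst P (sym (at-◂-zero x a)) px
    ◂-pointwise P x a px pa (suc n) = subst P (sym (at-◂-suc x a n)) (pa n)

    sup : (V → ℕ) → S → ℕ
    sup f a = List.foldr (λ x m → f x ℕ.⊔ m) (f (limit a)) (prefix a)

    limit-≤-sup : ∀ f a → f (limit a) ℕ.≤ sup f a
    limit-≤-sup f a = go (prefix a)
      where
      go : ∀ l → f (limit a) ℕ.≤ List.foldr (λ x m → f x ℕ.⊔ m) (f (limit a)) l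
      go []      = ℕ.≤-refl
      go (x ∷ l) = ℕ.≤-trans (go l) (ℕ.m≤n⊔m (f x) _)

    at-≤-sup : ∀ f a n → f (at′ a n) ℕ.≤ sup f a
    at-≤-sup f a = go (prefix a)
      where
      go : ∀ l n → f (valueAt _≟_ (limit a) l n) ℕ.≤ List.foldr (λ x m → f x ℕ.⊔ m) (f (limit a)) l
      go []      n       = ℕ.≤-refl
      go (x ∷ l) zero    = ℕ.m≤m⊔n (f x) _
      go (x ∷ l) (suc n) = ℕ.≤-trans (go l n) (ℕ.m≤n⊔m (f x) _)

    -- The sequence that is c at position n and d everywhere else.
    spike : ℕ → V → V → S
    spike zero    d c = c ◂ const _≟_ d
    spike (suc n) d c = d ◂ spike n d c

    limit-spike : ∀ n d c → limit (spike n d c) ≡ d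
    limit-spike zero    d c = refl
    limit-spike (suc n) d c = limit-spike n d c

    at-spike : ∀ n d c → at′ (spike n d c) n ≡ c
    at-spike zero    d c = at-◂-zero c (const _≟_ d)
    at-spike (suc n) d c = trans (at-◂-suc d (spike n d c) n) (at-spike n d c)

    spike-const : ∀ n d → spike n d d ≡ const _≟_ d
    spike-const zero    d = ◂-const d
    spike-const (suc n) d = trans (cong (d ◂_) (spike-const n d)) (◂-const d)

    spike-lift₁ : ∀ (i : Op₁ V) n d c → spike n (i d) (i c) ≡ lift₁ i (spike n d c)
    spike-lift₁ i zero    d c = ◂-lift₁ i c (const _≟_ d)
    spike-lift₁ i (suc n) d c = trans (cong (i d ◂_) (spike-lift₁ i n d c)) (◂-lift₁ i d (spike n d c))

    spike-lift₂ : ∀ (f : Op₂ V) n d d′ c c′ →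
                  spike n (f d d′) (f c c′) ≡ lift₂ f (spike n d c) (spike n d′ c′)
    spike-lift₂ f zero    d d′ c c′ = ◂-lift₂ f c c′ (const _≟_ d) (const _≟_ d′)
    spike-lift₂ f (suc n) d d′ c c′ =
      trans (cong (f d d′ ◂_) (spike-lift₂ f n d d′ c c′)) (◂-lift₂ f d d′ (spike n d c) (spike n d′ c′))

-- Lattice-ordered groups

module LGroupProperties (G : LGroup) where

  open LGroup G

  private
    abelianGroup : AbelianGroup _ _
    abelianGroup = record { isAbelianGroup = isAbelianGroup }

    lattice : Lattice _ _
    lattice = record { isLattice = isLattice }

    -- The library orders a lattice by x ≡ x ∧ y, the symmetric form of _≤_.
    module O = IsOrderLattice (LatticeProperties.∨-∧-isOrderTheoreticLattice lattice)

  open AbelianGroup abelianGroup public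
    using (assoc; comm; identityˡ; identityʳ; inverseˡ; inverseʳ)
  open AbelianGroupProperties abelianGroup public
    using (ε⁻¹≈ε; ⁻¹-involutive; ⁻¹-∙-comm; identityˡ-unique; inverseʳ-unique)
  open Lattice lattice public using (∧-comm; ∧-assoc; ∨-comm; ∨-assoc)
  open LatticeProperties lattice public using (∧-idem; ∨-idem)

  ≤-refl : ∀ {a} → a ≤ a
  ≤-refl {a} = ∧-idem a

  ≤-reflexive : ∀ {a b} → a ≡ b → a ≤ b
  ≤-reflexive refl = ≤-refl

  ≤-trans : ∀ {a b c} → a ≤ b → b ≤ c → a ≤ c
  ≤-trans p q = sym (O.trans (sym p) (sym q))

  ≤-antisym : ∀ {a b} → a ≤ b → b ≤ a → a ≡ b
  ≤-antisym p q = O.antisym (sym p) (sym q)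

  x∧y≤x : ∀ a b → a ∧ b ≤ a
  x∧y≤x a b = sym (O.x∧y≤x a b)

  x∧y≤y : ∀ a b → a ∧ b ≤ b
  x∧y≤y a b = sym (O.x∧y≤y a b)

  ∧-greatest : ∀ {a b c} → a ≤ b → a ≤ c → a ≤ b ∧ c
  ∧-greatest p q = sym (O.∧-greatest (sym p) (sym q))

  x≤x∨y : ∀ a b → a ≤ a ∨ b
  x≤x∨y a b = sym (O.x≤x∨y a b)

  y≤x∨y : ∀ a b → b ≤ a ∨ b
  y≤x∨y a b = sym (O.y≤x∨y a b)

  ∨-least : ∀ {a b c} → a ≤ c → b ≤ c → a ∨ b ≤ c
  ∨-least p q = sym (O.∨-least (sym p) (sym q))

  ∧-mono-≤ : ∀ {a b c d} → a ≤ b → c ≤ d → a ∧ c ≤ b ∧ d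
  ∧-mono-≤ p q = ∧-greatest (≤-trans (x∧y≤x _ _) p) (≤-trans (x∧y≤y _ _) q)

  ≤⇒∨≡ : ∀ {a b} → a ≤ b → a ∨ b ≡ b
  ≤⇒∨≡ {a} {b} p = ≤-antisym (∨-least p ≤-refl) (y≤x∨y a b)

  poset : Poset _ _ _
  poset = record
    { _≤_ = _≤_
    ; isPartialOrder = record
      { isPreorder = record { isEquivalence = isEquivalence ; reflexive = ≤-reflexive ; trans = ≤-trans }
      ; antisym = ≤-antisym } }

  module ≤-Reasoning = PosetReasoning poset

  x-x≡0 : ∀ a → a - a ≡ 0#
  x-x≡0 = inverseʳ

  x-0≡x : ∀ a → a - 0# ≡ a
  x-0≡x a = trans (cong (a +_) ε⁻¹≈ε) (identityʳ a)

  -x+[x+y]≡y : ∀ a b → - a + (a + b) ≡ b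
  -x+[x+y]≡y a b = trans (sym (assoc (- a) a b)) (trans (cong (_+ b) (inverseˡ a)) (identityˡ b))

  x+[-x+y]≡y : ∀ a b → a + (- a + b) ≡ b
  x+[-x+y]≡y a b = trans (sym (assoc a (- a) b)) (trans (cong (_+ b) (inverseʳ a)) (identityˡ b))

  [x-y]+y≡x : ∀ a b → (a - b) + b ≡ a
  [x-y]+y≡x a b = trans (assoc a (- b) b) (trans (cong (a +_) (inverseˡ b)) (identityʳ a))

  -‿distrib-+ : ∀ a b → - (a + b) ≡ - a + - b
  -‿distrib-+ a b = sym (⁻¹-∙-comm a b)

  x-[x-y]≡y : ∀ a b → a - (a - b) ≡ b
  x-[x-y]≡y a b = begin
    a + - (a + - b)     ≡⟨ cong (a +_) (-‿distrib-+ a (- b)) ⟩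
    a + (- a + - - b)   ≡⟨ x+[-x+y]≡y a (- - b) ⟩
    - - b               ≡⟨ ⁻¹-involutive b ⟩
    b                   ∎
    where open ≡-Reasoning

  x-[[x-y]+z]≡y-z : ∀ a b c → a - ((a - b) + c) ≡ b - c
  x-[[x-y]+z]≡y-z a b c = begin
    a + - ((a - b) + c)      ≡⟨ cong (a +_) (-‿distrib-+ (a - b) c) ⟩
    a + (- (a - b) + - c)    ≡⟨ assoc a (- (a - b)) (- c) ⟨
    (a - (a - b)) + - c      ≡⟨ cong (_+ - c) (x-[x-y]≡y a b) ⟩
    b - c                    ∎
    where open ≡-Reasoning

  +-monoʳ-≤ : ∀ c {a b} → a ≤ b → c + a ≤ c + b
  +-monoʳ-≤ c {a} {b} a≤b =
    subst (c + a ≤_) (trans (sym (+-distribˡ-∨ c a b)) (cong (c +_) (≤⇒∨≡ a≤b))) (x≤x∨y (c + a) (c + b))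

  +-monoˡ-≤ : ∀ c {a b} → a ≤ b → a + c ≤ b + c
  +-monoˡ-≤ c {a} {b} a≤b = subst₂ _≤_ (comm c a) (comm c b) (+-monoʳ-≤ c a≤b)

  +-mono-≤ : ∀ {a b c d} → a ≤ b → c ≤ d → a + c ≤ b + d
  +-mono-≤ {b = b} {c} a≤b c≤d = ≤-trans (+-monoˡ-≤ c a≤b) (+-monoʳ-≤ b c≤d)

  -‿antimono-≤ : ∀ {a b} → a ≤ b → - b ≤ - a
  -‿antimono-≤ {a} {b} a≤b = subst₂ _≤_ left right (+-monoʳ-≤ (- a + - b) a≤b)
    where
    left : (- a + - b) + a ≡ - b
    left = trans (cong (_+ a) (comm (- a) (- b))) (trans (assoc (- b) (- a) a)
             (trans (cong (- b +_) (inverseˡ a)) (identityʳ (- b))))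
    right : (- a + - b) + b ≡ - a
    right = [x-y]+y≡x (- a) b

  -‿distrib-∨ : ∀ a b → - (a ∨ b) ≡ (- a) ∧ (- b)
  -‿distrib-∨ a b = ≤-antisym
    (∧-greatest (-‿antimono-≤ (x≤x∨y a b)) (-‿antimono-≤ (y≤x∨y a b)))
    (subst (_≤ - (a ∨ b)) (⁻¹-involutive ((- a) ∧ (- b)))
      (-‿antimono-≤ (∨-least (neg-below a (x∧y≤x (- a) (- b))) (neg-below b (x∧y≤y (- a) (- b))))))
    where
    neg-below : ∀ x → (- a) ∧ (- b) ≤ - x → x ≤ - ((- a) ∧ (- b))
    neg-below x p = subst (_≤ - ((- a) ∧ (- b))) (⁻¹-involutive x) (-‿antimono-≤ p)

  -‿distrib-∧ : ∀ a b → - (a ∧ b) ≡ (- a) ∨ (- b)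
  -‿distrib-∧ a b = begin
    - (a ∧ b)               ≡⟨ cong₂ (λ x y → - (x ∧ y)) (⁻¹-involutive a) (⁻¹-involutive b) ⟨
    - ((- - a) ∧ (- - b))   ≡⟨ cong -_ (-‿distrib-∨ (- a) (- b)) ⟨
    - - ((- a) ∨ (- b))     ≡⟨ ⁻¹-involutive ((- a) ∨ (- b)) ⟩
    (- a) ∨ (- b)           ∎
    where open ≡-Reasoning

  -- Translation by c is an order automorphism with inverse translation by -c.
  +-distribˡ-∧ : ∀ c a b → c + (a ∧ b) ≡ (c + a) ∧ (c + b)
  +-distribˡ-∧ c a b = ≤-antisym
    (∧-greatest (+-monoʳ-≤ c (x∧y≤x a b)) (+-monoʳ-≤ c (x∧y≤y a b)))
    (subst (_≤ c + (a ∧ b)) (x+[-x+y]≡y c m)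
      (+-monoʳ-≤ c (∧-greatest (back a (x∧y≤x _ _)) (back b (x∧y≤y _ _)))))
    where
    m = (c + a) ∧ (c + b)
    back : ∀ x → m ≤ c + x → - c + m ≤ x
    back x p = subst (- c + m ≤_) (-x+[x+y]≡y c x) (+-monoʳ-≤ (- c) p)

  x-[y∧z]≡[x-y]∨[x-z] : ∀ c a b → c - (a ∧ b) ≡ (c - a) ∨ (c - b)
  x-[y∧z]≡[x-y]∨[x-z] c a b = trans (cong (c +_) (-‿distrib-∧ a b)) (+-distribˡ-∨ c (- a) (- b))

  x-[y∨z]≡[x-y]∧[x-z] : ∀ c a b → c - (a ∨ b) ≡ (c - a) ∧ (c - b)
  x-[y∨z]≡[x-y]∧[x-z] c a b = trans (cong (c +_) (-‿distrib-∨ a b)) (+-distribˡ-∧ c (- a) (- b))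

  x≤y⇒0≤y-x : ∀ {a b} → a ≤ b → 0# ≤ b - a
  x≤y⇒0≤y-x {a} {b} a≤b = subst (_≤ b - a) (x-x≡0 a) (+-monoˡ-≤ (- a) a≤b)

  0≤x⇒x∨0≡x : ∀ {a} → 0# ≤ a → a ∨ 0# ≡ a
  0≤x⇒x∨0≡x {a} 0≤a = trans (∨-comm a 0#) (≤⇒∨≡ 0≤a)

  0≤x⇒y≤y+x : ∀ {a} b → 0# ≤ a → b ≤ b + a
  0≤x⇒y≤y+x {a} b 0≤a = subst (_≤ b + a) (identityʳ b) (+-monoʳ-≤ b 0≤a)

  ∣-x∣≡∣x∣ : ∀ a → ∣ - a ∣ ≡ ∣ a ∣
  ∣-x∣≡∣x∣ a = trans (cong ((- a) ∨_) (⁻¹-involutive a)) (∨-comm (- a) a)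

  ∣x+y∣≤∣x∣+∣y∣ : ∀ a b → ∣ a + b ∣ ≤ ∣ a ∣ + ∣ b ∣
  ∣x+y∣≤∣x∣+∣y∣ a b = ∨-least
    (+-mono-≤ (x≤x∨y a (- a)) (x≤x∨y b (- b)))
    (subst (_≤ ∣ a ∣ + ∣ b ∣) (sym (-‿distrib-+ a b)) (+-mono-≤ (y≤x∨y a (- a)) (y≤x∨y b (- b))))

  0≤x⇒∣x∣∨0≡x : ∀ {a} → 0# ≤ a → ∣ a ∣ ∨ 0# ≡ a
  0≤x⇒∣x∣∨0≡x {a} 0≤a = ≤-antisym (∨-least (∨-least ≤-refl -a≤a) 0≤a) (≤-trans (x≤x∨y a (- a)) (x≤x∨y ∣ a ∣ 0#))
    where
    -a≤a : - a ≤ a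
    -a≤a = ≤-trans (subst (- a ≤_) ε⁻¹≈ε (-‿antimono-≤ 0≤a)) 0≤a

  [x+y]∧u≤[x∧u+y∧u]∧u : ∀ {a b u} → 0# ≤ a → 0# ≤ b → 0# ≤ u →
                        (a + b) ∧ u ≤ ((a ∧ u) + (b ∧ u)) ∧ u
  [x+y]∧u≤[x∧u+y∧u]∧u {a} {b} {u} 0≤a 0≤b 0≤u =
    ∧-greatest (subst (m ≤_) (sym expand) (∧-greatest (∧-greatest m≤a+b (≤u+ (0≤x⇒y≤y+x u 0≤b)))
                                          (∧-greatest (≤u+ (0≤x⇒y≤y+x u 0≤a)) (≤u+ (0≤x⇒y≤y+x u 0≤u)))))
               (x∧y≤y (a + b) u)
    where
    m = (a + b) ∧ u
    m≤a+b : m ≤ a + b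
    m≤a+b = x∧y≤x (a + b) u
    ≤u+ : ∀ {c} → u ≤ c → m ≤ c
    ≤u+ = ≤-trans (x∧y≤y (a + b) u)
    expand : (a ∧ u) + (b ∧ u) ≡ ((a + b) ∧ (u + b)) ∧ ((u + a) ∧ (u + u))
    expand = trans (+-distribˡ-∧ (a ∧ u) b u)
               (cong₂ _∧_ (trans (comm (a ∧ u) b) (trans (+-distribˡ-∧ b a u) (cong₂ _∧_ (comm b a) (comm b u))))
                          (trans (comm (a ∧ u) u) (+-distribˡ-∧ u a u)))

  ·-+ : ∀ m n a → (m ℕ.+ n) · a ≡ (m · a) + (n · a)
  ·-+ zero    n a = sym (identityˡ (n · a))
  ·-+ (suc m) n a = trans (cong (a +_) (·-+ m n a)) (sym (assoc a (m · a) (n · a)))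

  0≤x⇒0≤n·x : ∀ n {a} → 0# ≤ a → 0# ≤ n · a
  0≤x⇒0≤n·x zero    0≤a = ≤-refl
  0≤x⇒0≤n·x (suc n) {a} 0≤a = subst (_≤ a + (n · a)) (identityˡ 0#) (+-mono-≤ 0≤a (0≤x⇒0≤n·x n 0≤a))

  ·-monoˡ-≤ : ∀ {a} → 0# ≤ a → ∀ {m n} → m ℕ.≤ n → m · a ≤ n · a
  ·-monoˡ-≤ {a} 0≤a {m} m≤n = subst₂ _≤_ (identityʳ (m · a))
    (trans (sym (·-+ m k a)) (cong (_· a) (ℕ.m+[n∸m]≡n m≤n)))
    (+-monoʳ-≤ (m · a) (0≤x⇒0≤n·x k 0≤a))
    where k = _ ℕ.∸ m

  0-singular : IsSingular 0#
  0-singular = ≤-refl , λ a 0≤a a≤0 → begin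
    a ∧ (0# - a)     ≡⟨ cong (λ x → x ∧ (0# - x)) (≤-antisym a≤0 0≤a) ⟩
    0# ∧ (0# - 0#)   ≡⟨ cong (0# ∧_) (x-x≡0 0#) ⟩
    0# ∧ 0#          ≡⟨ ∧-idem 0# ⟩
    0#               ∎
    where open ≡-Reasoning

module LHomProperties {G H : LGroup} (h : LHom G H) where

  open LHom h
  private
    module G = LGroup G
    module H = LGroup H
    module PG = LGroupProperties G
    module PH = LGroupProperties H

  0#-hom : fun G.0# ≡ H.0#
  0#-hom = PH.identityˡ-unique (fun G.0#) (fun G.0#)
    (trans (sym (+-hom G.0# G.0#)) (cong fun (PG.identityˡ G.0#)))

  neg-hom : ∀ a → fun (G.- a) ≡ H.- fun a
  neg-hom a = PH.inverseʳ-unique (fun a) (fun (G.- a))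
    (trans (sym (+-hom a (G.- a))) (trans (cong fun (PG.inverseʳ a)) 0#-hom))

  sub-hom : ∀ a b → fun (a G.- b) ≡ fun a H.- fun b
  sub-hom a b = trans (+-hom a (G.- b)) (cong (fun a H.+_) (neg-hom b))

  ·-hom : ∀ n a → fun (n G.· a) ≡ n H.· fun a
  ·-hom zero    a = 0#-hom
  ·-hom (suc n) a = trans (+-hom a (n G.· a)) (cong (fun a H.+_) (·-hom n a))

  monotone : ∀ {a b} → a G.≤ b → fun a H.≤ fun b
  monotone {a} {b} a≤b = trans (sym (∧-hom a b)) (cong fun a≤b)

idᴸ : ∀ {G} → LHom G G
idᴸ = record { fun = λ a → a ; +-hom = λ _ _ → refl ; ∧-hom = λ _ _ → refl ; ∨-hom = λ _ _ → refl }

0ᴸ : ∀ {G H} → LHom G H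
0ᴸ {H = H} = record
  { fun   = λ _ → 0#
  ; +-hom = λ _ _ → sym (identityˡ 0#)
  ; ∧-hom = λ _ _ → sym (∧-idem 0#)
  ; ∨-hom = λ _ _ → sym (∨-idem 0#)
  }
  where
  open LGroup H
  open LGroupProperties H

infixr 9 _∘ᴸ_
_∘ᴸ_ : ∀ {G H K} → LHom H K → LHom G H → LHom G K
g ∘ᴸ f = record
  { fun   = λ a → G.fun (F.fun a)
  ; +-hom = λ a b → trans (cong G.fun (F.+-hom a b)) (G.+-hom _ _)
  ; ∧-hom = λ a b → trans (cong G.fun (F.∧-hom a b)) (G.∧-hom _ _)
  ; ∨-hom = λ a b → trans (cong G.fun (F.∨-hom a b)) (G.∨-hom _ _)
  }
  where
  module F = LHom f
  module G = LHom g

module _ {G : LGroup} where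

  open LGroup G

  Gen-map : ∀ {H P Q} (h : LHom G H) → (∀ {a} → P a → Q (LHom.fun h a)) →
            ∀ {a} → Gen P a → LGroup.Gen H Q (LHom.fun h a)
  Gen-map {H} h P⇒Q (gen-base p)  = LGroup.gen-base (P⇒Q p)
  Gen-map {H} h P⇒Q gen-zero      = subst (LGroup.Gen H _) (sym (LHomProperties.0#-hom h)) (LGroup.gen-zero)
  Gen-map {H} h P⇒Q (gen-neg p)   = subst (LGroup.Gen H _) (sym (LHomProperties.neg-hom h _)) (LGroup.gen-neg (Gen-map h P⇒Q p))
  Gen-map {H} h P⇒Q (gen-add p q) = subst (LGroup.Gen H _) (sym (LHom.+-hom h _ _)) (LGroup.gen-add (Gen-map h P⇒Q p) (Gen-map h P⇒Q q))

  Gen-vanishes : ∀ {H P} (h : LHom G H) → (∀ {a} → P a → LHom.fun h a ≡ LGroup.0# H) →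
                 ∀ {a} → Gen P a → LHom.fun h a ≡ LGroup.0# H
  Gen-vanishes {H} h P⇒0 (gen-base p)  = P⇒0 p
  Gen-vanishes {H} h P⇒0 gen-zero      = LHomProperties.0#-hom h
  Gen-vanishes {H} h P⇒0 (gen-neg p)   = trans (LHomProperties.neg-hom h _)
    (trans (cong (LGroup.-_ H) (Gen-vanishes h P⇒0 p)) (LGroupProperties.ε⁻¹≈ε H))
  Gen-vanishes {H} h P⇒0 (gen-add p q) = trans (LHom.+-hom h _ _)
    (trans (cong₂ (LGroup._+_ H) (Gen-vanishes h P⇒0 p) (Gen-vanishes h P⇒0 q)) (LGroupProperties.identityˡ H _))

ℤᴸ : LGroup
ℤᴸ = record
  { Carrier = ℤ ; _+_ = ℤ._+_ ; 0# = ℤ.+ 0 ; -_ = ℤ.-_ ; _∨_ = ℤ._⊔_ ; _∧_ = ℤ._⊓_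
  ; isAbelianGroup = ℤₚ.+-0-isAbelianGroup
  ; isLattice      = ℤₚ.⊔-⊓-isLattice
  ; +-distribˡ-∨   = λ a → ℤₚ.mono-≤-distrib-⊔ (ℤₚ.+-monoʳ-≤ a)
  }

infixr 2 _×ᴸ_
_×ᴸ_ : LGroup → LGroup → LGroup
G ×ᴸ H = record
  { Carrier = G.Carrier × H.Carrier
  ; _+_ = zip G._+_ H._+_
  ; 0#  = G.0# , H.0#
  ; -_  = λ p → (G.- proj₁ p) , (H.- proj₂ p)
  ; _∨_ = zip G._∨_ H._∨_
  ; _∧_ = zip G._∧_ H._∧_
  ; isAbelianGroup = record
    { isGroup = record
      { isMonoid = record
        { isSemigroup = record
          { isMagma = record { isEquivalence = isEquivalence ; ∙-cong = cong₂ _ }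
          ; assoc = λ a b c → cong₂ _,_ (PG.assoc _ _ _) (PH.assoc _ _ _) }
        ; identity = (λ a → cong₂ _,_ (PG.identityˡ _) (PH.identityˡ _))
                   , (λ a → cong₂ _,_ (PG.identityʳ _) (PH.identityʳ _)) }
      ; inverse = (λ a → cong₂ _,_ (PG.inverseˡ _) (PH.inverseˡ _))
                , (λ a → cong₂ _,_ (PG.inverseʳ _) (PH.inverseʳ _))
      ; ⁻¹-cong = cong (λ p → (G.- proj₁ p) , (H.- proj₂ p)) }
    ; comm = λ a b → cong₂ _,_ (PG.comm _ _) (PH.comm _ _) }
  ; isLattice = record
    { isEquivalence = isEquivalence
    ; ∨-comm  = λ a b → cong₂ _,_ (PG.∨-comm _ _) (PH.∨-comm _ _)
    ; ∨-assoc = λ a b c → cong₂ _,_ (PG.∨-assoc _ _ _) (PH.∨-assoc _ _ _)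
    ; ∨-cong  = cong₂ _
    ; ∧-comm  = λ a b → cong₂ _,_ (PG.∧-comm _ _) (PH.∧-comm _ _)
    ; ∧-assoc = λ a b c → cong₂ _,_ (PG.∧-assoc _ _ _) (PH.∧-assoc _ _ _)
    ; ∧-cong  = cong₂ _
    ; absorptive = (λ a b → cong₂ _,_ (proj₁ GL.absorptive _ _) (proj₁ HL.absorptive _ _))
                 , (λ a b → cong₂ _,_ (proj₂ GL.absorptive _ _) (proj₂ HL.absorptive _ _)) }
  ; +-distribˡ-∨ = λ a b c → cong₂ _,_ (G.+-distribˡ-∨ _ _ _) (H.+-distribˡ-∨ _ _ _)
  }
  where
  module G = LGroup G
  module H = LGroup H
  module PG = LGroupProperties G
  module PH = LGroupProperties H
  module GL = IsLattice G.isLattice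
  module HL = IsLattice H.isLattice

module _ {G H : LGroup} where

  proj₁ᴸ : LHom (G ×ᴸ H) G
  proj₁ᴸ = record { fun = proj₁ ; +-hom = λ _ _ → refl ; ∧-hom = λ _ _ → refl ; ∨-hom = λ _ _ → refl }

  proj₂ᴸ : LHom (G ×ᴸ H) H
  proj₂ᴸ = record { fun = proj₂ ; +-hom = λ _ _ → refl ; ∧-hom = λ _ _ → refl ; ∨-hom = λ _ _ → refl }

  ⟨_,_⟩ᴸ : ∀ {K} → LHom K G → LHom K H → LHom K (G ×ᴸ H)
  ⟨ f , g ⟩ᴸ = record
    { fun   = < F.fun , G′.fun >
    ; +-hom = λ a b → cong₂ _,_ (F.+-hom a b) (G′.+-hom a b)
    ; ∧-hom = λ a b → cong₂ _,_ (F.∧-hom a b) (G′.∧-hom a b)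
    ; ∨-hom = λ a b → cong₂ _,_ (F.∨-hom a b) (G′.∨-hom a b)
    }
    where
    module F = LHom f
    module G′ = LHom g

open EventuallyConstant
  using (Seq; seq; at; limit; prefix; const; lift₁; lift₂; at-lift₁; at-lift₂; _◂_; spike; spike-const; limit-spike; at-spike; at-limit)

module _ (G : LGroup) (_≟_ : DecidableEquality (LGroup.Carrier G)) where

  private
    module G = LGroup G
    module PG = LGroupProperties G
    module GL = IsLattice G.isLattice
    open EventuallyConstant

  Seqᴸ : LGroup
  Seqᴸ = record
    { Carrier = Seq _≟_
    ; _+_ = lift₂ G._+_
    ; 0#  = const _≟_ G.0#
    ; -_  = lift₁ (λ a → G.- a)
    ; _∨_ = lift₂ G._∨_
    ; _∧_ = lift₂ G._∧_
    ; isAbelianGroup = record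
      { isGroup = record
        { isMonoid = record
          { isSemigroup = record
            { isMagma = record { isEquivalence = isEquivalence ; ∙-cong = cong₂ _ }
            ; assoc = lift₂-assoc PG.assoc }
          ; identity = lift₂-identityˡ PG.identityˡ , lift₂-identityʳ PG.identityʳ }
        ; inverse = lift₂-inverseˡ PG.inverseˡ , lift₂-inverseʳ PG.inverseʳ
        ; ⁻¹-cong = cong (lift₁ (λ a → G.- a)) }
      ; comm = lift₂-comm PG.comm }
    ; isLattice = record
      { isEquivalence = isEquivalence
      ; ∨-comm  = lift₂-comm PG.∨-comm
      ; ∨-assoc = lift₂-assoc PG.∨-assoc
      ; ∨-cong  = cong₂ _
      ; ∧-comm  = lift₂-comm PG.∧-comm
      ; ∧-assoc = lift₂-assoc PG.∧-assoc
      ; ∧-cong  = cong₂ _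
      ; absorptive = lift₂-absorbs (proj₁ GL.absorptive) , lift₂-absorbs (proj₂ GL.absorptive) }
    ; +-distribˡ-∨ = lift₂-distribˡ G.+-distribˡ-∨
    }

  atᴸ : ℕ → LHom Seqᴸ G
  atᴸ n = record
    { fun = λ a → at _≟_ a n
    ; +-hom = λ a b → at-lift₂ G._+_ a b n
    ; ∧-hom = λ a b → at-lift₂ G._∧_ a b n
    ; ∨-hom = λ a b → at-lift₂ G._∨_ a b n
    }

  limitᴸ : LHom Seqᴸ G
  limitᴸ = record { fun = limit ; +-hom = λ _ _ → refl ; ∧-hom = λ _ _ → refl ; ∨-hom = λ _ _ → refl }

  constᴸ : LHom G Seqᴸ
  constᴸ = record { fun = const _≟_ ; +-hom = λ _ _ → refl ; ∧-hom = λ _ _ → refl ; ∨-hom = λ _ _ → refl }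

  prependᴸ : LHom Seqᴸ Seqᴸ
  prependᴸ = record
    { fun = G.0# ◂_
    ; +-hom = λ a b → sym (◂-lift₂-0 {G._+_} (PG.identityˡ G.0#) {a} {b})
    ; ∧-hom = λ a b → sym (◂-lift₂-0 {G._∧_} (PG.∧-idem G.0#) {a} {b})
    ; ∨-hom = λ a b → sym (◂-lift₂-0 {G._∨_} (PG.∨-idem G.0#) {a} {b})
    }
    where
    ◂-lift₂-0 : ∀ {f} → f G.0# G.0# ≡ G.0# → ∀ {a b} → lift₂ f (G.0# ◂ a) (G.0# ◂ b) ≡ G.0# ◂ lift₂ f a b
    ◂-lift₂-0 {f} f00 {a} {b} = trans (sym (◂-lift₂ f G.0# G.0# a b)) (cong (_◂ lift₂ f a b) f00)

  spikeᴸ : ℕ → LHom (G ×ᴸ G) Seqᴸ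
  spikeᴸ n = record
    { fun   = λ (d , c) → spike n d c
    ; +-hom = λ (d , c) (d′ , c′) → spike-lift₂ G._+_ n d d′ c c′
    ; ∧-hom = λ (d , c) (d′ , c′) → spike-lift₂ G._∧_ n d d′ c c′
    ; ∨-hom = λ (d , c) (d′ , c′) → spike-lift₂ G._∨_ n d d′ c c′
    }

  pointwise-≤ : ∀ a b → (∀ n → at _≟_ a n G.≤ at _≟_ b n) → LGroup._≤_ Seqᴸ a b
  pointwise-≤ a b a≤b = ext _≟_ λ n → trans (at-lift₂ G._∧_ a b n) (a≤b n)

  PointwiseSingular : Seq _≟_ → Set
  PointwiseSingular s = ∀ n → G.IsSingular (at _≟_ s n)

  pointwise-singular : ∀ {s} → PointwiseSingular s → LGroup.IsSingular Seqᴸ s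
  pointwise-singular {s} sing = pointwise-≤ (const _≟_ G.0#) s (λ n → proj₁ (sing n)) , λ a 0≤a a≤s →
    ext _≟_ λ n → begin
      at _≟_ (lift₂ G._∧_ a (lift₂ G._+_ s (lift₁ G.-_ a))) n
        ≡⟨ LHom.∧-hom (atᴸ n) a (lift₂ G._+_ s (lift₁ G.-_ a)) ⟩
      at _≟_ a n G.∧ at _≟_ (lift₂ G._+_ s (lift₁ G.-_ a)) n
        ≡⟨ cong (at _≟_ a n G.∧_) (LHomProperties.sub-hom (atᴸ n) s a) ⟩
      at _≟_ a n G.∧ (at _≟_ s n G.- at _≟_ a n)
        ≡⟨ proj₂ (sing n) _ (LHomProperties.monotone (atᴸ n) {b = a} 0≤a) (LHomProperties.monotone (atᴸ n) {a} {s} a≤s) ⟩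
      G.0# ∎
    where open ≡-Reasoning

  Seqᴸ-specker : G.IsSpecker → LGroup.IsSpecker Seqᴸ
  Seqᴸ-specker specker (seq c l t) = Gen-map idᴸ (λ {s} → pointwise-singular {s}) (generated c l t)
    where
    Gen′ = LGroup.Gen Seqᴸ PointwiseSingular

    generated : ∀ c l t → Gen′ (seq c l t)
    generated c [] t =
      subst Gen′ (ext _≟_ λ _ → refl) (Gen-map constᴸ (λ s _ → s) (specker c))
    generated c (x ∷ l) t = subst Gen′ decompose
      (LGroup.gen-add (Gen-map (spikeᴸ 0 ∘ᴸ ⟨_,_⟩ᴸ {G} {G} 0ᴸ idᴸ) (λ {y} s → ◂-pointwise G.IsSingular y (const _≟_ G.0#) s (λ _ → PG.0-singular)) (specker x))
                      (Gen-map prependᴸ (λ {a} → ◂-pointwise G.IsSingular G.0# a PG.0-singular)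
                        (generated c l (trimmed-tail _≟_ c x l t))))
      where
      τ = seq c l (trimmed-tail _≟_ c x l t)
      decompose : lift₂ G._+_ (x ◂ const _≟_ G.0#) (G.0# ◂ τ) ≡ seq c (x ∷ l) t
      decompose = begin
        lift₂ G._+_ (x ◂ const _≟_ G.0#) (G.0# ◂ τ)  ≡⟨ ◂-lift₂ G._+_ x G.0# (const _≟_ G.0#) τ ⟨
        (x G.+ G.0#) ◂ lift₂ G._+_ (const _≟_ G.0#) τ ≡⟨ cong₂ _◂_ (PG.identityʳ x) (lift₂-identityˡ PG.identityˡ τ) ⟩
        x ◂ τ                                          ≡⟨ ◂-seq c x l t ⟩
        seq c (x ∷ l) t                                ∎
        where open ≡-Reasoning

  Seqᴸ-unit : ∀ {u} → G.IsUnit u → LGroup.IsUnit Seqᴸ (const _≟_ u)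
  Seqᴸ-unit {u} (0≤u , bounded) = pointwise-≤ (const _≟_ G.0#) (const _≟_ u) (λ _ → 0≤u) , λ σ →
    N σ , ℕ.<-≤-trans (proj₁ (proj₂ (bounded (limit σ)))) (limit-≤-sup Nₓ σ) ,
    pointwise-≤ (S.∣ σ ∣) (N σ S.· const _≟_ u) (bound-at σ)
    where
    module S = LGroup Seqᴸ
    Nₓ : G.Carrier → ℕ
    Nₓ g = proj₁ (bounded g)
    N : Seq _≟_ → ℕ
    N = sup Nₓ
    bound-at : ∀ σ n → at _≟_ S.∣ σ ∣ n G.≤ at _≟_ (N σ S.· const _≟_ u) n
    bound-at σ n = subst₂ G._≤_ (sym at-abs) (sym (LHomProperties.·-hom (atᴸ n) (N σ) (const _≟_ u)))
      (PG.≤-trans (proj₂ (proj₂ (bounded σₙ))) (PG.·-monoˡ-≤ 0≤u (at-≤-sup Nₓ σ n)))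
      where
      σₙ = at _≟_ σ n
      at-abs : at _≟_ S.∣ σ ∣ n ≡ G.∣ σₙ ∣
      at-abs = trans (LHom.∨-hom (atᴸ n) σ (S.- σ)) (cong (σₙ G.∨_) (LHomProperties.neg-hom (atᴸ n) σ))

module _ {G H : LGroup} where

  private
    module G = LGroup G
    module H = LGroup H
    module GH = LGroup (G ×ᴸ H)
    module PG = LGroupProperties G
    module PH = LGroupProperties H

  ×-singular : ∀ {s t} → G.IsSingular s → H.IsSingular t → GH.IsSingular (s , t)
  ×-singular (0≤s , sing-s) (0≤t , sing-t) = cong₂ _,_ 0≤s 0≤t , λ a 0≤a a≤st →
    cong₂ _,_ (sing-s (proj₁ a) (cong proj₁ 0≤a) (cong proj₁ a≤st))
              (sing-t (proj₂ a) (cong proj₂ 0≤a) (cong proj₂ a≤st))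

  ×ᴸ-specker : G.IsSpecker → H.IsSpecker → GH.IsSpecker
  ×ᴸ-specker specker-G specker-H (g , h) = subst (GH.Gen GH.IsSingular) (cong₂ _,_ (PG.identityʳ g) (PH.identityˡ h))
    (GH.gen-add (Gen-map (⟨_,_⟩ᴸ {G} {H} idᴸ 0ᴸ) (λ s → ×-singular s PH.0-singular) (specker-G g))
                (Gen-map (⟨_,_⟩ᴸ {G} {H} 0ᴸ idᴸ) (λ s → ×-singular PG.0-singular s) (specker-H h)))

  ×ᴸ-unit : ∀ {u v} → G.IsUnit u → H.IsUnit v → GH.IsUnit (u , v)
  ×ᴸ-unit {u} {v} (0≤u , bounded-G) (0≤v , bounded-H) = cong₂ _,_ 0≤u 0≤v , bounded
    where
    bounded : ∀ gh → Σ ℕ λ k → (0 ℕ.< k) × (GH.∣ gh ∣ GH.≤ k GH.· (u , v))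
    bounded (g , h) with bounded-G g | bounded-H h
    ... | m , 0<m , g≤mu | n , _ , h≤nv =
      m ℕ.+ n , ℕ.<-≤-trans 0<m (ℕ.m≤m+n m n) ,
      subst (GH._≤_ (G.∣ g ∣ , H.∣ h ∣))
            (sym (cong₂ _,_ (LHomProperties.·-hom (proj₁ᴸ {G} {H}) (m ℕ.+ n) (u , v))
                            (LHomProperties.·-hom (proj₂ᴸ {G} {H}) (m ℕ.+ n) (u , v))))
            (cong₂ _,_ (PG.≤-trans g≤mu (PG.·-monoˡ-≤ 0≤u {m} {m ℕ.+ n} (ℕ.m≤m+n m n)))
                       (PH.≤-trans h≤nv (PH.·-monoˡ-≤ 0≤v {n} {m ℕ.+ n} (ℕ.m≤n+m n m))))

module _ where

  open LGroup ℤᴸ using (IsSingular; IsSpecker; IsUnit; Gen; gen-base; gen-zero; gen-neg; gen-add; _·_; ∣_∣)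
  open import Data.Integer using (+_; _+_; _-_; _⊓_)

  1-singular : IsSingular (+ 1)
  1-singular = refl , singular
    where
    singular : ∀ a → + 0 ⊓ a ≡ + 0 → a ⊓ + 1 ≡ a → a ⊓ (+ 1 - a) ≡ + 0
    singular (+ 0)             _ _  = refl
    singular (+ 1)             _ _  = refl
    singular (+ suc (suc n))   _ ()
    singular -[1+ n ]            () _

  ℤᴸ-specker : IsSpecker
  ℤᴸ-specker (+ n)    = multiple-of-1 n
    where
    multiple-of-1 : ∀ n → Gen IsSingular (+ n)
    multiple-of-1 zero    = gen-zero
    multiple-of-1 (suc n) = gen-add (gen-base 1-singular) (multiple-of-1 n)
  ℤᴸ-specker -[1+ n ] = gen-neg (ℤᴸ-specker (+ suc n))

  ℤᴸ-unit : ∀ k .{{_ : ℕ.NonZero k}} → IsUnit (+ k)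
  ℤᴸ-unit k = refl , λ g → suc ℤ.∣ g ∣ , ℕ.z<s ,
    subst₂ (λ a b → a ⊓ b ≡ a) (sym (∣∣≡+∣∣ g)) (sym (·≡* (suc ℤ.∣ g ∣)))
      (ℤₚ.i≤j⇒i⊓j≡i (ℤ.+≤+ (ℕ.≤-trans (ℕ.n≤1+n _) (ℕ.m≤m*n (suc ℤ.∣ g ∣) k))))
    where
    ∣∣≡+∣∣ : ∀ g → ∣ g ∣ ≡ + ℤ.∣ g ∣
    ∣∣≡+∣∣ (+ zero)  = refl
    ∣∣≡+∣∣ (+ suc n) = refl
    ∣∣≡+∣∣ -[1+ n ]    = refl
    ·≡* : ∀ n → n · (+ k) ≡ + (n ℕ.* k)
    ·≡* zero    = refl
    ·≡* (suc n) = cong (λ i → + k + i) (·≡* n)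

ℤᵘ : (k : ℕ) .{{_ : ℕ.NonZero k}} → USℓg
ℤᵘ k = record { group = ℤᴸ ; unit = ℤ.+ k ; isUnit = ℤᴸ-unit k ; specker = ℤᴸ-specker }

infixr 2 _×ᵘ_
_×ᵘ_ : USℓg → USℓg → USℓg
S ×ᵘ T = record
  { group   = group S ×ᴸ group T
  ; unit    = unit S , unit T
  ; isUnit  = ×ᴸ-unit {group S} {group T} (isUnit S) (isUnit T)
  ; specker = ×ᴸ-specker {group S} {group T} (specker S) (specker T)
  }
  where open USℓg

Seqᵘ : (S : USℓg) → DecidableEquality (LGroup.Carrier (USℓg.group S)) → USℓg
Seqᵘ S _≟_ = record
  { group   = Seqᴸ group _≟_
  ; unit    = const _≟_ unit
  ; isUnit  = Seqᴸ-unit group _≟_ isUnit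
  ; specker = Seqᴸ-specker group _≟_ specker
  }
  where open USℓg S

-- MV-algebras and Γ

module MVOperations (M : MVAlgebra) where

  open MVAlgebra M

  infixl 6 _⊖_
  _⊖_ : Op₂ Carrier
  x ⊖ y = ∼ (∼ x ⊕ y)

  infixl 7 _⋀_
  _⋀_ : Op₂ Carrier
  x ⋀ y = x ⊖ (x ⊖ y)

module MVHomProperties {M N : MVAlgebra} (h : MVHom M N) where

  open MVHom h
  private
    module M = MVAlgebra M
    module N = MVAlgebra N
    module OM = MVOperations M
    module ON = MVOperations N

  ⊖-hom : ∀ x y → fun (x OM.⊖ y) ≡ fun x ON.⊖ fun y
  ⊖-hom x y = trans (¬-hom _) (cong N.∼_ (trans (⊕-hom _ y) (cong (N._⊕ fun y) (¬-hom x))))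

  ⋀-hom : ∀ x y → fun (x OM.⋀ y) ≡ fun x ON.⋀ fun y
  ⋀-hom x y = trans (⊖-hom x _) (cong (fun x ON.⊖_) (⊖-hom x y))

idᴹ : ∀ {M} → MVHom M M
idᴹ = record { fun = λ x → x ; ⊕-hom = λ _ _ → refl ; ¬-hom = λ _ → refl ; 0-hom = refl }

infixr 9 _∘ᴹ_
_∘ᴹ_ : ∀ {M N K} → MVHom N K → MVHom M N → MVHom M K
g ∘ᴹ f = record
  { fun   = λ x → G.fun (F.fun x)
  ; ⊕-hom = λ x y → trans (cong G.fun (F.⊕-hom x y)) (G.⊕-hom _ _)
  ; ¬-hom = λ x → trans (cong G.fun (F.¬-hom x)) (G.¬-hom _)
  ; 0-hom = trans (cong G.fun F.0-hom) G.0-hom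
  }
  where
  module F = MVHom f
  module G = MVHom g

infixr 2 _×ᴹ_
_×ᴹ_ : MVAlgebra → MVAlgebra → MVAlgebra
M ×ᴹ N = record
  { Carrier = M.Carrier × N.Carrier
  ; _⊕_ = zip M._⊕_ N._⊕_
  ; ∼_  = λ (x , y) → M.∼ x , N.∼ y
  ; 0#  = M.0# , N.0#
  ; ⊕-assoc      = λ x y z → cong₂ _,_ (M.⊕-assoc _ _ _) (N.⊕-assoc _ _ _)
  ; ⊕-comm       = λ x y → cong₂ _,_ (M.⊕-comm _ _) (N.⊕-comm _ _)
  ; ⊕-identityʳ  = λ x → cong₂ _,_ (M.⊕-identityʳ _) (N.⊕-identityʳ _)
  ; ¬-involutive = λ x → cong₂ _,_ (M.¬-involutive _) (N.¬-involutive _)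
  ; ⊕-zeroʳ      = λ x → cong₂ _,_ (M.⊕-zeroʳ _) (N.⊕-zeroʳ _)
  ; łukasiewicz  = λ x y → cong₂ _,_ (M.łukasiewicz _ _) (N.łukasiewicz _ _)
  }
  where
  module M = MVAlgebra M
  module N = MVAlgebra N

module _ {M N : MVAlgebra} where

  proj₁ᴹ : MVHom (M ×ᴹ N) M
  proj₁ᴹ = record { fun = proj₁ ; ⊕-hom = λ _ _ → refl ; ¬-hom = λ _ → refl ; 0-hom = refl }

  proj₂ᴹ : MVHom (M ×ᴹ N) N
  proj₂ᴹ = record { fun = proj₂ ; ⊕-hom = λ _ _ → refl ; ¬-hom = λ _ → refl ; 0-hom = refl }

  ⟨_,_⟩ᴹ : ∀ {K} → MVHom K M → MVHom K N → MVHom K (M ×ᴹ N)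
  ⟨ f , g ⟩ᴹ = record
    { fun   = < F.fun , G.fun >
    ; ⊕-hom = λ x y → cong₂ _,_ (F.⊕-hom x y) (G.⊕-hom x y)
    ; ¬-hom = λ x → cong₂ _,_ (F.¬-hom x) (G.¬-hom x)
    ; 0-hom = cong₂ _,_ F.0-hom G.0-hom
    }
    where
    module F = MVHom f
    module G = MVHom g

module _ (M : MVAlgebra) (_≟_ : DecidableEquality (MVAlgebra.Carrier M)) where

  private
    module M = MVAlgebra M
    at′ = at _≟_
    ⊕′ : Op₂ (Seq _≟_)
    ⊕′ = lift₂ M._⊕_
    ∼′ : Op₁ (Seq _≟_)
    ∼′ = lift₁ M.∼_

    at-łukasiewicz : ∀ x y n → at′ (⊕′ (∼′ (⊕′ (∼′ x) y)) y) n ≡ M.∼ (M.∼ at′ x n M.⊕ at′ y n) M.⊕ at′ y n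
    at-łukasiewicz x y n = begin
      at′ (⊕′ (∼′ (⊕′ (∼′ x) y)) y) n                   ≡⟨ at-lift₂ M._⊕_ (∼′ (⊕′ (∼′ x) y)) y n ⟩
      at′ (∼′ (⊕′ (∼′ x) y)) n M.⊕ at′ y n              ≡⟨ cong (M._⊕ at′ y n) (at-lift₁ M.∼_ (⊕′ (∼′ x) y) n) ⟩
      M.∼ at′ (⊕′ (∼′ x) y) n M.⊕ at′ y n               ≡⟨ cong (λ z → M.∼ z M.⊕ at′ y n) (at-lift₂ M._⊕_ (∼′ x) y n) ⟩
      M.∼ (at′ (∼′ x) n M.⊕ at′ y n) M.⊕ at′ y n        ≡⟨ cong (λ z → M.∼ (z M.⊕ at′ y n) M.⊕ at′ y n) (at-lift₁ M.∼_ x n) ⟩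
      M.∼ (M.∼ at′ x n M.⊕ at′ y n) M.⊕ at′ y n         ∎
      where open ≡-Reasoning

  Seqᴹ : MVAlgebra
  Seqᴹ = record
    { Carrier = Seq _≟_
    ; _⊕_ = ⊕′
    ; ∼_  = ∼′
    ; 0#  = const _≟_ M.0#
    ; ⊕-assoc      = lift₂-assoc M.⊕-assoc
    ; ⊕-comm       = lift₂-comm M.⊕-comm
    ; ⊕-identityʳ  = lift₂-identityʳ M.⊕-identityʳ
    ; ¬-involutive = lift₁-involutive M.¬-involutive
    ; ⊕-zeroʳ      = λ x → ext _≟_ λ n →
        trans (at-lift₂ M._⊕_ x (∼′ (const _≟_ M.0#)) n) (M.⊕-zeroʳ (at′ x n))
    ; łukasiewicz  = λ x y → ext _≟_ λ n →
        trans (at-łukasiewicz x y n) (trans (M.łukasiewicz _ _) (sym (at-łukasiewicz y x n)))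
    }
    where open EventuallyConstant

  atᴹ : ℕ → MVHom Seqᴹ M
  atᴹ n = record
    { fun   = λ x → at′ x n
    ; ⊕-hom = λ x y → at-lift₂ M._⊕_ x y n
    ; ¬-hom = λ x → at-lift₁ M.∼_ x n
    ; 0-hom = refl
    }

  limitᴹ : MVHom Seqᴹ M
  limitᴹ = record { fun = limit ; ⊕-hom = λ _ _ → refl ; ¬-hom = λ _ → refl ; 0-hom = refl }

  spikeᴹ : ℕ → MVHom (M ×ᴹ M) Seqᴹ
  spikeᴹ n = record
    { fun   = λ (d , c) → spike n d c
    ; ⊕-hom = λ (d , c) (d′ , c′) → EventuallyConstant.spike-lift₂ {_≟_ = _≟_} M._⊕_ n d d′ c c′
    ; ¬-hom = λ (d , c) → EventuallyConstant.spike-lift₁ {_≟_ = _≟_} M.∼_ n d c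
    ; 0-hom = spike-const n M.0#
    }

IsoΓ : MVAlgebra → (G : LGroup) → LGroup.Carrier G → Set
IsoΓ A G u =
  Σ (A.Carrier → G.Carrier) λ φ →
    (∀ x y → φ x ≡ φ y → x ≡ y)
  × (∀ x → (G.0# G.≤ φ x) × (φ x G.≤ u))
  × (∀ y → G.0# G.≤ y → y G.≤ u → Σ A.Carrier λ x → φ x ≡ y)
  × (φ A.0# ≡ G.0#)
  × (∀ x y → φ (x A.⊕ y) ≡ (φ x G.+ φ y) G.∧ u)
  × (∀ x → φ (A.∼ x) ≡ u G.- φ x)
  where
  module A = MVAlgebra A
  module G = LGroup G

module ΓCalculus {A : MVAlgebra} {G : LGroup} {u : LGroup.Carrier G} (iso : IsoΓ A G u) where

  private
    module A = MVAlgebra A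
  open LGroup G
  open LGroupProperties G
  open MVOperations A

  φ : A.Carrier → Carrier
  φ = proj₁ iso

  φ-injective : ∀ x y → φ x ≡ φ y → x ≡ y
  φ-injective = proj₁ (proj₂ iso)

  φ-bounded : ∀ x → (0# ≤ φ x) × (φ x ≤ u)
  φ-bounded = proj₁ (proj₂ (proj₂ iso))

  φ-onto : ∀ y → 0# ≤ y → y ≤ u → Σ A.Carrier λ x → φ x ≡ y
  φ-onto = proj₁ (proj₂ (proj₂ (proj₂ iso)))

  φ-0 : φ A.0# ≡ 0#
  φ-0 = proj₁ (proj₂ (proj₂ (proj₂ (proj₂ iso))))

  φ-⊕ : ∀ x y → φ (x A.⊕ y) ≡ (φ x + φ y) ∧ u
  φ-⊕ = proj₁ (proj₂ (proj₂ (proj₂ (proj₂ (proj₂ iso)))))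

  φ-∼ : ∀ x → φ (A.∼ x) ≡ u - φ x
  φ-∼ = proj₂ (proj₂ (proj₂ (proj₂ (proj₂ (proj₂ iso)))))

  0≤u : 0# ≤ u
  0≤u = subst (_≤ u) φ-0 (proj₂ (φ-bounded A.0#))

  φ-⊖ : ∀ x y → φ (x ⊖ y) ≡ (φ x - φ y) ∨ 0#
  φ-⊖ x y = begin
    φ (A.∼ (A.∼ x A.⊕ y))                   ≡⟨ φ-∼ (A.∼ x A.⊕ y) ⟩
    u - φ (A.∼ x A.⊕ y)                     ≡⟨ cong (λ z → u - z) (φ-⊕ (A.∼ x) y) ⟩
    u - ((φ (A.∼ x) + φ y) ∧ u)             ≡⟨ cong (λ z → u - ((z + φ y) ∧ u)) (φ-∼ x) ⟩
    u - (((u - φ x) + φ y) ∧ u)             ≡⟨ x-[y∧z]≡[x-y]∨[x-z] u ((u - φ x) + φ y) u ⟩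
    (u - ((u - φ x) + φ y)) ∨ (u - u)       ≡⟨ cong₂ _∨_ (x-[[x-y]+z]≡y-z u (φ x) (φ y)) (x-x≡0 u) ⟩
    (φ x - φ y) ∨ 0#                        ∎
    where open ≡-Reasoning

  φ-⋀ : ∀ x y → φ (x ⋀ y) ≡ φ x ∧ φ y
  φ-⋀ x y = begin
    φ (x ⊖ (x ⊖ y))                           ≡⟨ φ-⊖ x (x ⊖ y) ⟩
    (φ x - φ (x ⊖ y)) ∨ 0#                    ≡⟨ cong (λ z → (φ x - z) ∨ 0#) (φ-⊖ x y) ⟩
    (φ x - ((φ x - φ y) ∨ 0#)) ∨ 0#           ≡⟨ cong (_∨ 0#) (x-[y∨z]≡[x-y]∧[x-z] (φ x) (φ x - φ y) 0#) ⟩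
    ((φ x - (φ x - φ y)) ∧ (φ x - 0#)) ∨ 0#   ≡⟨ cong₂ (λ a b → (a ∧ b) ∨ 0#) (x-[x-y]≡y (φ x) (φ y)) (x-0≡x (φ x)) ⟩
    (φ y ∧ φ x) ∨ 0#                          ≡⟨ 0≤x⇒x∨0≡x (∧-greatest (proj₁ (φ-bounded y)) (proj₁ (φ-bounded x))) ⟩
    φ y ∧ φ x                                 ≡⟨ ∧-comm (φ y) (φ x) ⟩
    φ x ∧ φ y                                 ∎
    where open ≡-Reasoning

  -- Every g is first clamped into [0, u], so that φ⁻¹ is total.
  φ⁻¹ : Carrier → A.Carrier
  φ⁻¹ g = proj₁ (φ-onto ((g ∨ 0#) ∧ u) (∧-greatest (y≤x∨y g 0#) 0≤u) (x∧y≤y (g ∨ 0#) u))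

  φ-φ⁻¹ : ∀ {g} → 0# ≤ g → g ≤ u → φ (φ⁻¹ g) ≡ g
  φ-φ⁻¹ {g} 0≤g g≤u = trans (proj₂ (φ-onto _ _ _)) (trans (cong (_∧ u) (0≤x⇒x∨0≡x 0≤g)) g≤u)

  ⋀-split-below-singular : ∀ {s} → IsSingular s → ∀ {x} → φ x ≤ s → ∀ y → (y ⋀ x) ⋀ (x ⊖ (y ⋀ x)) ≡ A.0#
  ⋀-split-below-singular {s} (_ , disjoint) {x} φx≤s y = φ-injective _ _ (begin
    φ (a ⋀ c)       ≡⟨ φ-⋀ a c ⟩
    φ a ∧ φ c       ≡⟨ ≤-antisym
                         (subst (φ a ∧ φ c ≤_) (disjoint (φ a) (proj₁ (φ-bounded a)) φa≤s) (∧-mono-≤ ≤-refl φc≤s-φa))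
                         (∧-greatest (proj₁ (φ-bounded a)) (proj₁ (φ-bounded c))) ⟩
    0#              ≡⟨ φ-0 ⟨
    φ A.0#          ∎)
    where
    open ≡-Reasoning
    a = y ⋀ x
    c = x ⊖ a
    φa≤φx : φ a ≤ φ x
    φa≤φx = subst (_≤ φ x) (sym (φ-⋀ y x)) (x∧y≤y (φ y) (φ x))
    φa≤s : φ a ≤ s
    φa≤s = ≤-trans φa≤φx φx≤s
    φc≤s-φa : φ c ≤ s - φ a
    φc≤s-φa = subst (_≤ s - φ a) (sym (φ-⊖ x a)) (∨-least (+-monoˡ-≤ (- φ a) φx≤s) (x≤y⇒0≤y-x φa≤s))

×-iso : ∀ {A B G H u v} → IsoΓ A G u → IsoΓ B H v → IsoΓ (A ×ᴹ B) (G ×ᴸ H) (u , v)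
×-iso {A} {B} {G} {H} {u} {v} isoA isoB =
    (λ (x , y) → φ x , ψ y)
  , (λ (x , y) (x′ , y′) eq → cong₂ _,_ (φ-injective x x′ (cong proj₁ eq)) (ψ-injective y y′ (cong proj₂ eq)))
  , (λ (x , y) → cong₂ _,_ (proj₁ (φ-bounded x)) (proj₁ (ψ-bounded y))
               , cong₂ _,_ (proj₂ (φ-bounded x)) (proj₂ (ψ-bounded y)))
  , (λ (g , h) 0≤gh gh≤uv →
       let (x , φx≡g) = φ-onto g (cong proj₁ 0≤gh) (cong proj₁ gh≤uv)
           (y , ψy≡h) = ψ-onto h (cong proj₂ 0≤gh) (cong proj₂ gh≤uv)
       in (x , y) , cong₂ _,_ φx≡g ψy≡h)
  , cong₂ _,_ φ-0 ψ-0
  , (λ (x , y) (x′ , y′) → cong₂ _,_ (φ-⊕ x x′) (ψ-⊕ y y′))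
  , (λ (x , y) → cong₂ _,_ (φ-∼ x) (ψ-∼ y))
  where
  open ΓCalculus {A} {G} {u} isoA
  open ΓCalculus {B} {H} {v} isoB using () renaming
    (φ to ψ; φ-injective to ψ-injective; φ-bounded to ψ-bounded; φ-onto to ψ-onto; φ-0 to ψ-0; φ-⊕ to ψ-⊕; φ-∼ to ψ-∼)

module _ {A : MVAlgebra} {G : LGroup} {u : LGroup.Carrier G}
         (_≟A_ : DecidableEquality (MVAlgebra.Carrier A)) (_≟G_ : DecidableEquality (LGroup.Carrier G))
         (iso : IsoΓ A G u) where

  private
    module A = MVAlgebra A
    module G = LGroup G
    module SA = MVAlgebra (Seqᴹ A _≟A_)
    module SG = LGroup (Seqᴸ G _≟G_)
    open ΓCalculus {A} {G} {u} iso
    open EventuallyConstant using (map; at-map; ext)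

    atₙ : ℕ → LHom (Seqᴸ G _≟G_) G
    atₙ = atᴸ G _≟G_

    φ̂ : Seq _≟A_ → Seq _≟G_
    φ̂ = map φ

    at-φ̂ : ∀ x n → at _≟G_ (φ̂ x) n ≡ φ (at _≟A_ x n)
    at-φ̂ = at-map φ

    0≤φ̂ : ∀ x → SG.0# SG.≤ φ̂ x
    0≤φ̂ x = pointwise-≤ G _≟G_ SG.0# (φ̂ x) λ n → subst (G.0# G.≤_) (sym (at-φ̂ x n)) (proj₁ (φ-bounded _))

    φ̂≤u : ∀ x → φ̂ x SG.≤ const _≟G_ u
    φ̂≤u x = pointwise-≤ G _≟G_ (φ̂ x) (const _≟G_ u) λ n → subst (G._≤ u) (sym (at-φ̂ x n)) (proj₂ (φ-bounded _))

    φ̂-onto : ∀ y → SG.0# SG.≤ y → y SG.≤ const _≟G_ u → Σ (Seq _≟A_) λ x → φ̂ x ≡ y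
    φ̂-onto y 0≤y y≤u = map φ⁻¹ y , ext _≟G_ λ n →
      trans (at-φ̂ (map φ⁻¹ y) n) (trans (cong φ (at-map φ⁻¹ y n))
        (φ-φ⁻¹ (LHomProperties.monotone (atₙ n) {b = y} 0≤y) (LHomProperties.monotone (atₙ n) {y} {const _≟G_ u} y≤u)))

    φ̂-⊕ : ∀ x y → φ̂ (x SA.⊕ y) ≡ (φ̂ x SG.+ φ̂ y) SG.∧ const _≟G_ u
    φ̂-⊕ x y = ext _≟G_ λ n → begin
      at _≟G_ (φ̂ (x SA.⊕ y)) n                         ≡⟨ at-φ̂ (x SA.⊕ y) n ⟩
      φ (at _≟A_ (x SA.⊕ y) n)                         ≡⟨ cong φ (at-lift₂ A._⊕_ x y n) ⟩
      φ (at _≟A_ x n A.⊕ at _≟A_ y n)                  ≡⟨ φ-⊕ _ _ ⟩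
      (φ (at _≟A_ x n) G.+ φ (at _≟A_ y n)) G.∧ u      ≡⟨ cong₂ (λ a b → (a G.+ b) G.∧ u) (at-φ̂ x n) (at-φ̂ y n) ⟨
      (at _≟G_ (φ̂ x) n G.+ at _≟G_ (φ̂ y) n) G.∧ u     ≡⟨ cong (G._∧ u) (LHom.+-hom (atₙ n) (φ̂ x) (φ̂ y)) ⟨
      at _≟G_ (φ̂ x SG.+ φ̂ y) n G.∧ u                   ≡⟨ LHom.∧-hom (atₙ n) (φ̂ x SG.+ φ̂ y) (const _≟G_ u) ⟨
      at _≟G_ ((φ̂ x SG.+ φ̂ y) SG.∧ const _≟G_ u) n     ∎
      where open ≡-Reasoning

    φ̂-∼ : ∀ x → φ̂ (SA.∼ x) ≡ const _≟G_ u SG.- φ̂ x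
    φ̂-∼ x = ext _≟G_ λ n → begin
      at _≟G_ (φ̂ (SA.∼ x)) n                ≡⟨ at-φ̂ (SA.∼ x) n ⟩
      φ (at _≟A_ (SA.∼ x) n)                ≡⟨ cong φ (at-lift₁ A.∼_ x n) ⟩
      φ (A.∼ at _≟A_ x n)                   ≡⟨ φ-∼ _ ⟩
      u G.- φ (at _≟A_ x n)                 ≡⟨ cong (λ z → u G.- z) (at-φ̂ x n) ⟨
      u G.- at _≟G_ (φ̂ x) n                 ≡⟨ LHomProperties.sub-hom (atₙ n) (const _≟G_ u) (φ̂ x) ⟨
      at _≟G_ (const _≟G_ u SG.- φ̂ x) n     ∎
      where open ≡-Reasoning

  Seq-iso : IsoΓ (Seqᴹ A _≟A_) (Seqᴸ G _≟G_) (const _≟G_ u)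
  Seq-iso =
      φ̂
    , (λ x y eq → ext _≟A_ λ n →
         φ-injective _ _ (trans (sym (at-φ̂ x n)) (trans (cong (λ z → at _≟G_ z n) eq) (at-φ̂ y n))))
    , (λ x → 0≤φ̂ x , φ̂≤u x)
    , φ̂-onto
    , ext _≟G_ (λ n → trans (at-φ̂ SA.0# n) φ-0)
    , φ̂-⊕
    , φ̂-∼

module Chain (k : ℕ) where

  open import Data.Integer using (+_; _+_; _-_; _⊓_)

  Ł : Set
  Ł = Fin (suc k)

  truncate : ℕ → Ł
  truncate n = Fin.fromℕ< (ℕ.s≤s (ℕ.m⊓n≤n n k))

  toℕ-truncate : ∀ {n} → n ℕ.≤ k → toℕ (truncate n) ≡ n
  toℕ-truncate {n} n≤k = trans (Fin.toℕ-fromℕ< _) (ℕ.m≤n⇒m⊓n≡m n≤k)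

  infixl 6 _⊕_
  _⊕_ : Op₂ Ł
  x ⊕ y = truncate (toℕ x ℕ.+ toℕ y)

  ∼_ : Op₁ Ł
  ∼_ = Fin.opposite

  φ : Ł → ℤ
  φ x = + toℕ x

  Laws : Set
  Laws = (∀ x y z → (x ⊕ y) ⊕ z ≡ x ⊕ (y ⊕ z))
       × (∀ x y → x ⊕ y ≡ y ⊕ x)
       × (∀ x → x ⊕ zero ≡ x)
       × (∀ x → ∼ ∼ x ≡ x)
       × (∀ x → x ⊕ ∼ zero ≡ ∼ zero)
       × (∀ x y → ∼ (∼ x ⊕ y) ⊕ y ≡ ∼ (∼ y ⊕ x) ⊕ x)
       × (∀ x y → φ (x ⊕ y) ≡ (φ x + φ y) ⊓ + k)
       × (∀ x → φ (∼ x) ≡ + k - φ x)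

  laws? : Dec Laws
  laws? = all³ (λ x y z → (x ⊕ y) ⊕ z Fin.≟ x ⊕ (y ⊕ z))
    ×-dec all² (λ x y → x ⊕ y Fin.≟ y ⊕ x)
    ×-dec Fin.all? (λ x → x ⊕ zero Fin.≟ x)
    ×-dec Fin.all? (λ x → ∼ ∼ x Fin.≟ x)
    ×-dec Fin.all? (λ x → x ⊕ ∼ zero Fin.≟ ∼ zero)
    ×-dec all² (λ x y → ∼ (∼ x ⊕ y) ⊕ y Fin.≟ ∼ (∼ y ⊕ x) ⊕ x)
    ×-dec all² (λ x y → φ (x ⊕ y) ℤ.≟ (φ x + φ y) ⊓ + k)
    ×-dec Fin.all? (λ x → φ (∼ x) ℤ.≟ + k - φ x)
    where
    all² : ∀ {P : Ł → Ł → Set} → (∀ x y → Dec (P x y)) → Dec (∀ x y → P x y)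
    all² P? = Fin.all? λ x → Fin.all? (P? x)
    all³ : ∀ {P : Ł → Ł → Ł → Set} → (∀ x y z → Dec (P x y z)) → Dec (∀ x y z → P x y z)
    all³ P? = Fin.all? λ x → all² (P? x)

module _ (k : ℕ) (laws : Chain.Laws k) where

  open Chain k
  open import Data.Integer using (+_; _⊓_)

  Łᴹ : MVAlgebra
  Łᴹ = algebra laws
    where
    algebra : Laws → MVAlgebra
    algebra (assoc , comm , identityʳ , involutive , zeroʳ , łuk , _) = record
      { Carrier = Ł ; _⊕_ = _⊕_ ; ∼_ = ∼_ ; 0# = zero
      ; ⊕-assoc = assoc ; ⊕-comm = comm ; ⊕-identityʳ = identityʳ
      ; ¬-involutive = involutive ; ⊕-zeroʳ = zeroʳ ; łukasiewicz = łuk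
      }

  Ł-iso : IsoΓ Łᴹ ℤᴸ (+ k)
  Ł-iso = iso laws
    where
    onto : ∀ y → + 0 ⊓ y ≡ + 0 → y ⊓ + k ≡ y → Σ Ł λ x → φ x ≡ y
    onto (+ n)    _  n⊓k≡n = truncate n , cong +_ (toℕ-truncate (ℕ.m⊓n≡m⇒m≤n (ℤₚ.+-injective n⊓k≡n)))
    onto -[1+ n ] () _
    iso : Laws → IsoΓ Łᴹ ℤᴸ (+ k)
    iso (_ , _ , _ , _ , _ , _ , φ-⊕ , φ-∼) =
        φ
      , (λ x y φx≡φy → Fin.toℕ-injective (ℤₚ.+-injective φx≡φy))
      , (λ x → refl , ℤₚ.i≤j⇒i⊓j≡i (ℤ.+≤+ (Fin.toℕ≤pred[n] x)))
      , onto
      , refl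
      , φ-⊕
      , φ-∼

Łˢ : (k : ℕ) .{{_ : ℕ.NonZero k}} → Chain.Laws k → SMVObj
Łˢ k laws = record { alg = Łᴹ k laws ; speckerGroup = ℤᵘ k ; iso = Ł-iso k laws }

infixr 2 _×ˢ_
_×ˢ_ : SMVObj → SMVObj → SMVObj
A ×ˢ B = record
  { alg          = A.alg ×ᴹ B.alg
  ; speckerGroup = A.speckerGroup ×ᵘ B.speckerGroup
  ; iso          = ×-iso {A.alg} {B.alg} {USℓg.group A.speckerGroup} {USℓg.group B.speckerGroup} A.iso B.iso
  }
  where
  module A = SMVObj A
  module B = SMVObj B

Seqˢ : (A : SMVObj) →
       DecidableEquality (MVAlgebra.Carrier (SMVObj.alg A)) →
       DecidableEquality (LGroup.Carrier (USℓg.group (SMVObj.speckerGroup A))) →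
       SMVObj
Seqˢ A _≟A_ _≟G_ = record
  { alg          = Seqᴹ alg _≟A_
  ; speckerGroup = Seqᵘ speckerGroup _≟G_
  ; iso          = Seq-iso {alg} {USℓg.group speckerGroup} {USℓg.unit speckerGroup} _≟A_ _≟G_ iso
  }
  where open SMVObj A

-- The counterexamples

module _ (C : ConcreteCat) where

  open ConcreteCat C

  NoEqualizingCone : ∀ {A B T} → Hom A B → Hom A B → (ℕ → Hom T A) → Set₁
  NoEqualizingCone {A} {B} {T} f g z =
    ∀ E (e : Hom E A) → (∀ x → ap f (ap e x) ≡ ap g (ap e x)) →
    (∀ n → Σ (Hom T E) λ h → ∀ x → ap e (ap h x) ≡ ap (z n) x) → ⊥

  no-equalizer : ∀ {A B T} {f g : Hom A B} {z : ℕ → Hom T A} →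
                 (∀ n x → ap f (ap (z n) x) ≡ ap g (ap (z n) x)) →
                 NoEqualizingCone f g z → ¬ HasEqualizer C f g
  no-equalizer {T = T} {z = z} z-equalizes no-cone (E , e , e-equalizes , universal) =
    no-cone E e e-equalizes λ n → let (h , e∘h≡z , _) = universal T (z n) (z-equalizes n) in h , e∘h≡z

  no-pullback : ∀ {A B B² T} {f g : Hom A B} {fg : Hom A B²} {Δ : Hom B B²} {z : ℕ → Hom T A}
                (q : Hom T B) →
                (∀ a b → ap fg a ≡ ap Δ b → ap f a ≡ ap g a) →
                (∀ n x → ap fg (ap (z n) x) ≡ ap Δ (ap q x)) →
                NoEqualizingCone f g z → ¬ HasPullback C fg Δ
  no-pullback {T = T} {z = z} q square⇒equal z-commutes no-cone (P , p₁ , p₂ , commutes , universal) =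
    no-cone P p₁ (λ x → square⇒equal _ _ (commutes x))
      λ n → let (h , (p₁∘h≡z , _) , _) = universal T (z n) q (z-commutes n) in h , p₁∘h≡z



doubleᴸ : LHom ℤᴸ ℤᴸ
doubleᴸ = record
  { fun   = λ a → a ℤ.+ a
  ; +-hom = λ a b → CommutativeSemigroupProperties.interchange ℤₚ.+-commutativeSemigroup a b a b
  ; ∧-hom = ℤₚ.mono-≤-distrib-⊓ (λ p → ℤₚ.+-mono-≤ p p)
  ; ∨-hom = ℤₚ.mono-≤-distrib-⊔ (λ p → ℤₚ.+-mono-≤ p p)
  }

Seqℤ : LGroup
Seqℤ = Seqᴸ ℤᴸ ℤ._≟_

Aᵘ Bᵘ Tᵘ B²ᵘ : USℓg
Aᵘ  = Seqᵘ (ℤᵘ 2) ℤ._≟_ ×ᵘ ℤᵘ 1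
Bᵘ  = ℤᵘ 2
Tᵘ  = ℤᵘ 1 ×ᵘ ℤᵘ 2
B²ᵘ = Bᵘ ×ᵘ Bᵘ

fᵘ gᵘ : USℓgHom Aᵘ Bᵘ
fᵘ = record { hom = limitᴸ ℤᴸ ℤ._≟_ ∘ᴸ proj₁ᴸ {Seqℤ} {ℤᴸ} ; unit-hom = refl }
gᵘ = record { hom = doubleᴸ ∘ᴸ proj₂ᴸ {Seqℤ} {ℤᴸ} ; unit-hom = refl }

zᵘ : ℕ → USℓgHom Tᵘ Aᵘ
zᵘ n = record
  { hom      = ⟨_,_⟩ᴸ {Seqℤ} {ℤᴸ} (spikeᴸ ℤᴸ ℤ._≟_ n ∘ᴸ ⟨_,_⟩ᴸ {ℤᴸ} {ℤᴸ} (doubleᴸ ∘ᴸ proj₁ᴸ {ℤᴸ} {ℤᴸ}) (proj₂ᴸ {ℤᴸ} {ℤᴸ})) (proj₁ᴸ {ℤᴸ} {ℤᴸ})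
  ; unit-hom = cong (_, ℤ.+ 1) (spike-const n (ℤ.+ 2))
  }

qᵘ : USℓgHom Tᵘ Bᵘ
qᵘ = record { hom = doubleᴸ ∘ᴸ proj₁ᴸ {ℤᴸ} {ℤᴸ} ; unit-hom = refl }

⟨f,g⟩ᵘ : USℓgHom Aᵘ B²ᵘ
⟨f,g⟩ᵘ = record { hom = ⟨ USℓgHom.hom fᵘ , USℓgHom.hom gᵘ ⟩ᴸ ; unit-hom = refl }

Δᵘ : USℓgHom Bᵘ B²ᵘ
Δᵘ = record { hom = ⟨ idᴸ , idᴸ ⟩ᴸ ; unit-hom = refl }

module _ where

  open import Data.Integer using (+_; _+_; _-_; _⊓_)

  k+k≢1 : ∀ k → k + k ≢ + 1
  k+k≢1 (+ zero)  ()
  k+k≢1 (+ suc n) eq = ℕ.m+1+n≢0 n (ℕ.suc-injective (ℤₚ.+-injective eq))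
  k+k≢1 -[1+ n ]  ()

  -- For 0 ≤ w, the condition says that 1 ⊓ w is a component of w, i.e. w ∈ {0, 1}.
  even-split-by-1⇒0 : ∀ w k → + 0 ⊓ w ≡ + 0 → w ≡ k + k → (+ 1 ⊓ w) ⊓ (w - (+ 1 ⊓ w)) ≡ + 0 → w ≡ + 0
  even-split-by-1⇒0 (+ 0)             k _  _    _  = refl
  even-split-by-1⇒0 (+ 1)             k _  1≡2k _  = ⊥-elim (k+k≢1 k (sym 1≡2k))
  even-split-by-1⇒0 (+ suc (suc m))   k _  _    ()
  even-split-by-1⇒0 -[1+ n ]          k () _    _

no-Specker-equalizing-coneᵘ : NoEqualizingCone uSℓg {Aᵘ} {Bᵘ} {Tᵘ} fᵘ gᵘ zᵘ
no-Specker-equalizing-coneᵘ E e equalizes factors =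
  2≢0 (Gen-vanishes L singular⇒L≡0 (USℓg.specker E (USℓg.unit E)))
  where
  open LGroup (USℓg.group E)
  open LGroupProperties (USℓg.group E)
  open import Data.Integer using (+_; _⊓_)

  module e = LHom (USℓgHom.hom e)

  L : LHom (USℓg.group E) ℤᴸ
  L = limitᴸ ℤᴸ ℤ._≟_ ∘ᴸ proj₁ᴸ {Seqℤ} {ℤᴸ} ∘ᴸ USℓgHom.hom e

  evaluate : ℕ → LHom (USℓg.group E) ℤᴸ
  evaluate n = atᴸ ℤᴸ ℤ._≟_ n ∘ᴸ proj₁ᴸ {Seqℤ} {ℤᴸ} ∘ᴸ USℓgHom.hom e

  2≢0 : LHom.fun L (USℓg.unit E) ≢ + 0
  2≢0 eq with trans (sym (cong (λ p → limit (proj₁ p)) (USℓgHom.unit-hom e))) eq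
  ... | ()

  singular⇒L≡0 : ∀ {s} → IsSingular s → LHom.fun L s ≡ + 0
  singular⇒L≡0 {s} (0≤s , disjoint) = trans (sym w≡Ls) (even-split-by-1⇒0 w k 0≤w w≡k+k split)
    where
    n = length (prefix (proj₁ (e.fun s)))
    module evₙ = LHom (evaluate n)
    w = evₙ.fun s
    k = proj₂ (e.fun s)
    w≡Ls : w ≡ LHom.fun L s
    w≡Ls = at-limit ℤ._≟_ (proj₁ (e.fun s))
    w≡k+k : w ≡ k ℤ.+ k
    w≡k+k = trans w≡Ls (equalizes s)
    0≤w : + 0 ⊓ w ≡ + 0
    0≤w = subst (λ z → z ⊓ w ≡ z) (LHomProperties.0#-hom (evaluate n)) (LHomProperties.monotone (evaluate n) 0≤s)
    h = proj₁ (factors n)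
    y = LHom.fun (USℓgHom.hom h) (+ 0 , + 1)
    0≤y : 0# ≤ y
    0≤y = subst (_≤ y) (LHomProperties.0#-hom (USℓgHom.hom h))
            (LHomProperties.monotone (USℓgHom.hom h) {+ 0 , + 0} {+ 0 , + 1} refl)
    y↦1 : evₙ.fun y ≡ + 1
    y↦1 = trans (cong (λ p → at ℤ._≟_ (proj₁ p) n) (proj₂ (factors n) (+ 0 , + 1))) (at-spike n (+ 0) (+ 1))
    a = y ∧ s
    a↦1⊓w : evₙ.fun a ≡ + 1 ⊓ w
    a↦1⊓w = trans (evₙ.∧-hom y s) (cong (_⊓ w) y↦1)
    split : (+ 1 ⊓ w) ⊓ (w ℤ.- (+ 1 ⊓ w)) ≡ + 0
    split = begin
      (+ 1 ⊓ w) ⊓ (w ℤ.- (+ 1 ⊓ w))     ≡⟨ cong₂ (λ b c → b ⊓ (w ℤ.- c)) a↦1⊓w a↦1⊓w ⟨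
      evₙ.fun a ⊓ (w ℤ.- evₙ.fun a)     ≡⟨ cong (evₙ.fun a ⊓_) (LHomProperties.sub-hom (evaluate n) s a) ⟨
      evₙ.fun a ⊓ evₙ.fun (s - a)       ≡⟨ evₙ.∧-hom a (s - a) ⟨
      evₙ.fun (a ∧ (s - a))             ≡⟨ cong evₙ.fun (disjoint a (∧-greatest 0≤y 0≤s) (x∧y≤y y s)) ⟩
      evₙ.fun 0#                        ≡⟨ LHomProperties.0#-hom (evaluate n) ⟩
      + 0                               ∎
      where open ≡-Reasoning

-- Opaque, so that type checking never unfolds (and re-runs) the exhaustive check.
opaque
  Ł₁-laws : Chain.Laws 1
  Ł₁-laws = from-yes (Chain.laws? 1)

  Ł₂-laws : Chain.Laws 2
  Ł₂-laws = from-yes (Chain.laws? 2)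

Ł₁ˢ Ł₂ˢ : SMVObj
Ł₁ˢ = Łˢ 1 Ł₁-laws
Ł₂ˢ = Łˢ 2 Ł₂-laws

Ł₁ᴹ Ł₂ᴹ : MVAlgebra
Ł₁ᴹ = SMVObj.alg Ł₁ˢ
Ł₂ᴹ = SMVObj.alg Ł₂ˢ

double : Fin 2 → Fin 3
double zero    = zero
double (suc _) = suc (suc zero)

doubleᴹ : MVHom (Ł₁ᴹ) Ł₂ᴹ
doubleᴹ = record
  { fun   = double
  ; ⊕-hom = from-yes (Fin.all? λ x → Fin.all? λ y → double (x Ł₁.⊕ y) Fin.≟ double x Ł₂.⊕ double y)
  ; ¬-hom = from-yes (Fin.all? λ x → double (Ł₁.∼ x) Fin.≟ Ł₂.∼ double x)
  ; 0-hom = refl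
  }
  where
  module Ł₁ = Chain 1
  module Ł₂ = Chain 2

SeqŁ : MVAlgebra
SeqŁ = Seqᴹ Ł₂ᴹ Fin._≟_

Aˢ Bˢ Tˢ B²ˢ : SMVObj
Aˢ  = Seqˢ (Ł₂ˢ) Fin._≟_ ℤ._≟_ ×ˢ Ł₁ˢ
Bˢ  = Ł₂ˢ
Tˢ  = Ł₁ˢ ×ˢ Ł₂ˢ
B²ˢ = Bˢ ×ˢ Bˢ

fˢ gˢ : SMVHom Aˢ Bˢ
fˢ = limitᴹ Ł₂ᴹ Fin._≟_ ∘ᴹ proj₁ᴹ {SeqŁ} {Ł₁ᴹ}
gˢ = doubleᴹ ∘ᴹ proj₂ᴹ {SeqŁ} {Ł₁ᴹ}

zˢ : ℕ → SMVHom Tˢ Aˢ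
zˢ n = ⟨_,_⟩ᴹ {SeqŁ} {Ł₁ᴹ} (spikeᴹ Ł₂ᴹ Fin._≟_ n ∘ᴹ ⟨_,_⟩ᴹ {Ł₂ᴹ} {Ł₂ᴹ} (doubleᴹ ∘ᴹ proj₁ᴹ) (proj₂ᴹ {Ł₁ᴹ} {Ł₂ᴹ})) (proj₁ᴹ {Ł₁ᴹ} {Ł₂ᴹ})

qˢ : SMVHom Tˢ Bˢ
qˢ = doubleᴹ ∘ᴹ proj₁ᴹ {Ł₁ᴹ} {Ł₂ᴹ}

⟨f,g⟩ˢ : SMVHom Aˢ B²ˢ
⟨f,g⟩ˢ = ⟨ fˢ , gˢ ⟩ᴹ

Δˢ : SMVHom Bˢ B²ˢ
Δˢ = ⟨ idᴹ , idᴹ ⟩ᴹ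

module _ where

  open MVAlgebra Ł₂ᴹ using (_⊕_)
  open MVOperations Ł₂ᴹ

  even-split-by-1⇒0ᴹ : ∀ w b → w ≡ double b → (suc zero ⋀ w) ⋀ (w ⊖ (suc zero ⋀ w)) ≡ zero → w ≡ zero
  even-split-by-1⇒0ᴹ zero                b             _  _  = refl
  even-split-by-1⇒0ᴹ (suc zero)          zero          () _
  even-split-by-1⇒0ᴹ (suc zero)          (suc zero)    () _
  even-split-by-1⇒0ᴹ (suc (suc zero))    b             _  ()

no-Specker-equalizing-coneˢ : NoEqualizingCone SMV {Aˢ} {Bˢ} {Tˢ} fˢ gˢ zˢ
no-Specker-equalizing-coneˢ E e equalizes factors =
  unit-not-bounded (generated⇒bounded (USℓg.specker S u))
  where
  M = SMVObj.alg E
  S = SMVObj.speckerGroup E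
  u = USℓg.unit S
  module M = MVAlgebra M
  module e = MVHom e
  open LGroup (USℓg.group S)
  open LGroupProperties (USℓg.group S)
  open MVOperations M
  open ΓCalculus {M} {USℓg.group S} {u} (SMVObj.iso E)

  Λ : MVHom M Ł₂ᴹ
  Λ = fˢ ∘ᴹ e

  evaluate : ℕ → MVHom M Ł₂ᴹ
  evaluate n = atᴹ Ł₂ᴹ Fin._≟_ n ∘ᴹ proj₁ᴹ {SeqŁ} {Ł₁ᴹ} ∘ᴹ e

  singular-truncation-in-kernel : ∀ {s} → IsSingular s → Σ M.Carrier λ x → (φ x ≡ s ∧ u) × (MVHom.fun Λ x ≡ zero)
  singular-truncation-in-kernel {s} s-singular@(0≤s , _) =
    x , φx≡s∧u , trans (sym w≡Λx) (even-split-by-1⇒0ᴹ w _ (trans w≡Λx (equalizes x)) split)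
    where
    x = φ⁻¹ (s ∧ u)
    φx≡s∧u : φ x ≡ s ∧ u
    φx≡s∧u = φ-φ⁻¹ (∧-greatest 0≤s 0≤u) (x∧y≤y s u)
    n = length (prefix (proj₁ (e.fun x)))
    module evₙ = MVHom (evaluate n)
    module evₙ′ = MVHomProperties (evaluate n)
    module Ł₂ = MVOperations Ł₂ᴹ
    w = evₙ.fun x
    w≡Λx : w ≡ MVHom.fun Λ x
    w≡Λx = at-limit Fin._≟_ (proj₁ (e.fun x))
    y = MVHom.fun (proj₁ (factors n)) (zero , suc zero)
    y↦1 : evₙ.fun y ≡ suc zero
    y↦1 = trans (cong (λ p → at Fin._≟_ (proj₁ p) n) (proj₂ (factors n) (zero , suc zero)))
                (at-spike n zero (suc zero))
    a↦ : evₙ.fun (y ⋀ x) ≡ suc zero Ł₂.⋀ w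
    a↦ = trans (evₙ′.⋀-hom y x) (cong (Ł₂._⋀ w) y↦1)
    split : (suc zero Ł₂.⋀ w) Ł₂.⋀ (w Ł₂.⊖ (suc zero Ł₂.⋀ w)) ≡ zero
    split = begin
      (suc zero Ł₂.⋀ w) Ł₂.⋀ (w Ł₂.⊖ (suc zero Ł₂.⋀ w))   ≡⟨ cong₂ (λ b c → b Ł₂.⋀ (w Ł₂.⊖ c)) a↦ a↦ ⟨
      evₙ.fun (y ⋀ x) Ł₂.⋀ (w Ł₂.⊖ evₙ.fun (y ⋀ x))       ≡⟨ cong (evₙ.fun (y ⋀ x) Ł₂.⋀_) (evₙ′.⊖-hom x (y ⋀ x)) ⟨
      evₙ.fun (y ⋀ x) Ł₂.⋀ evₙ.fun (x ⊖ (y ⋀ x))          ≡⟨ evₙ′.⋀-hom (y ⋀ x) (x ⊖ (y ⋀ x)) ⟨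
      evₙ.fun ((y ⋀ x) ⋀ (x ⊖ (y ⋀ x)))                   ≡⟨ cong evₙ.fun (⋀-split-below-singular s-singular φx≤s y) ⟩
      evₙ.fun M.0#                                        ≡⟨ evₙ.0-hom ⟩
      zero                                                ∎
      where
      open ≡-Reasoning
      φx≤s : φ x ≤ s
      φx≤s = subst (_≤ s) (sym φx≡s∧u) (x∧y≤x s u)

  Bounded : Carrier → Set
  Bounded g = Σ M.Carrier λ x → (MVHom.fun Λ x ≡ zero) × ((∣ g ∣ ∨ 0#) ∧ u ≤ φ x)

  generated⇒bounded : ∀ {g} → Gen IsSingular g → Bounded g
  generated⇒bounded (gen-base {s} s-singular) =
    let (x , φx≡s∧u , Λx≡0) = singular-truncation-in-kernel s-singular
    in x , Λx≡0 , ≤-reflexive (trans (cong (_∧ u) (0≤x⇒∣x∣∨0≡x (proj₁ s-singular))) (sym φx≡s∧u))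
  generated⇒bounded gen-zero =
    M.0# , MVHom.0-hom Λ , ≤-reflexive (trans (cong (_∧ u) (0≤x⇒∣x∣∨0≡x ≤-refl)) (trans 0≤u (sym φ-0)))
  generated⇒bounded (gen-neg {g} p) =
    let (x , Λx≡0 , bound) = generated⇒bounded p
    in x , Λx≡0 , subst (λ z → (z ∨ 0#) ∧ u ≤ φ x) (sym (∣-x∣≡∣x∣ g)) bound
  generated⇒bounded (gen-add {g} {h} p q) =
    let (x , Λx≡0 , g≤) = generated⇒bounded p
        (x′ , Λx′≡0 , h≤) = generated⇒bounded q
    in x M.⊕ x′ , trans (MVHom.⊕-hom Λ x x′) (cong₂ (MVAlgebra._⊕_ Ł₂ᴹ) Λx≡0 Λx′≡0) , (begin
      (∣ g + h ∣ ∨ 0#) ∧ u                           ≤⟨ ∧-mono-≤ triangle (≤-refl {u}) ⟩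
      (g⁺ + h⁺) ∧ u                                  ≤⟨ [x+y]∧u≤[x∧u+y∧u]∧u (y≤x∨y ∣ g ∣ 0#) (y≤x∨y ∣ h ∣ 0#) 0≤u ⟩
      ((g⁺ ∧ u) + (h⁺ ∧ u)) ∧ u                      ≤⟨ ∧-mono-≤ (+-mono-≤ g≤ h≤) (≤-refl {u}) ⟩
      (φ x + φ x′) ∧ u                               ≡⟨ φ-⊕ x x′ ⟨
      φ (x M.⊕ x′)                                   ∎)
    where
    open ≤-Reasoning
    g⁺ = ∣ g ∣ ∨ 0#
    h⁺ = ∣ h ∣ ∨ 0#
    triangle : ∣ g + h ∣ ∨ 0# ≤ g⁺ + h⁺
    triangle = ∨-least (≤-trans (∣x+y∣≤∣x∣+∣y∣ g h) (+-mono-≤ (x≤x∨y ∣ g ∣ 0#) (x≤x∨y ∣ h ∣ 0#)))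
                       (subst (_≤ g⁺ + h⁺) (identityˡ 0#) (+-mono-≤ (y≤x∨y ∣ g ∣ 0#) (y≤x∨y ∣ h ∣ 0#)))

  unit-not-bounded : Bounded u → ⊥
  unit-not-bounded (x , Λx≡0 , u≤φx)
    with trans (sym (trans (cong (MVHom.fun Λ) x≡1) Λ1≡2)) Λx≡0
    where
    Λ1≡2 : MVHom.fun Λ (M.∼ M.0#) ≡ suc (suc zero)
    Λ1≡2 = trans (MVHom.¬-hom Λ M.0#) (cong (MVAlgebra.∼_ Ł₂ᴹ) (MVHom.0-hom Λ))
    x≡1 : x ≡ M.∼ M.0#
    x≡1 = φ-injective _ _ (trans
      (≤-antisym (proj₂ (φ-bounded x)) (subst (_≤ φ x) (trans (cong (_∧ u) (0≤x⇒∣x∣∨0≡x 0≤u)) (∧-idem u)) u≤φx))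
      (sym (trans (φ-∼ M.0#) (trans (cong (λ z → u - z) φ-0) (x-0≡x u)))))
  ... | ()

corollary7p4 : (LacksSomePullback uSℓg × LacksSomeEqualizer uSℓg)
    × (LacksSomePullback SMV × LacksSomeEqualizer SMV)
corollary7p4 =
    ( (Aᵘ , Bᵘ , B²ᵘ , ⟨f,g⟩ᵘ , Δᵘ ,
       no-pullback uSℓg {Aᵘ} {Bᵘ} {B²ᵘ} {Tᵘ} {fᵘ} {gᵘ} {⟨f,g⟩ᵘ} {Δᵘ} {zᵘ} qᵘ
         (λ _ _ → ×-diagonal) (λ n (c , _) → cong (_, c ℤ.+ c) (limit-spike n (c ℤ.+ c) _)) no-Specker-equalizing-coneᵘ)
    , (Aᵘ , Bᵘ , fᵘ , gᵘ ,
       no-equalizer uSℓg {Aᵘ} {Bᵘ} {Tᵘ} {fᵘ} {gᵘ} {zᵘ} (λ n (c , _) → limit-spike n (c ℤ.+ c) _)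
         no-Specker-equalizing-coneᵘ) )
  , ( (Aˢ , Bˢ , B²ˢ , ⟨f,g⟩ˢ , Δˢ ,
       no-pullback SMV {Aˢ} {Bˢ} {B²ˢ} {Tˢ} {fˢ} {gˢ} {⟨f,g⟩ˢ} {Δˢ} {zˢ} qˢ
         (λ _ _ → ×-diagonal) (λ n (c , _) → cong (_, double c) (limit-spike n (double c) _)) no-Specker-equalizing-coneˢ)
    , (Aˢ , Bˢ , fˢ , gˢ ,
       no-equalizer SMV {Aˢ} {Bˢ} {Tˢ} {fˢ} {gˢ} {zˢ} (λ n (c , _) → limit-spike n (double c) _)
         no-Specker-equalizing-coneˢ) )
  where
  ×-diagonal : ∀ {X : Set} {a b c : X} → (a , b) ≡ (c , c) → a ≡ b
  ×-diagonal eq = trans (cong proj₁ eq) (sym (cong proj₂ eq))
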